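{- For every $n\ge 1$, $$\sum_{P\in\mathcal D_n} q^{\mathrm{speaks}\,P}\,t^{\mathrm{npeaks}\,P}=\sum_{P\in\mathcal D_n} q^{\mathrm{stunnels}\,P}\,t^{\,n-\mathrm{des}\,P}.$$
   Context: $\mathcal D_n$ is the set of Dyck paths of semilength $n$: words $s_1\ldots s_{2n}$ with $n$ letters $U$ (step $(1,1)$) and $n$ letters $D$ (step $(1,-1)$) such that every prefix has at least as many $U$'s as $D$'s; viewed as lattice paths from $(0,0)$ to $(2n,0)$ staying weakly above the $x$-axis. A peak is a factor $s_is_{i+1}=UD$, with height $\mathrm{ht}(p)=\#\{j\le i:s_j=U\}-\#\{j\le i:s_j=D\}$ (the $y$-coordinate of its top point); $\mathrm{npeaks}\,P$ is the number of peaks and $\mathrm{speaks}\,P=\sum_p(\mathrm{ht}(p)-1)$ over all peaks. A valley is a factor $s_js_{j+1}=DU$; $\mathrm{des}\,P$ is the number of valleys. For a valley $v$ whose lowest lattice point is $(x_v,h_v)$, let $x'_v$ be the largest $x<x_v$ such that the path passes through $(x,h_v)$; the tunnel of $v$ has semilength $(x_v-x'_v)/2$, and $\mathrm{stunnels}\,P$ is the sum of the semilengths of the tunnels of all valleys of $P$. -}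

module Defs where

open import Level using (Level)
open import Data.Bool using (Bool; true; false; _∧_; if_then_else_)
open import Data.Nat using (ℕ; zero; suc; _+_; _*_; _∸_; _≡ᵇ_; _/_)
open import Data.List using (List; []; _∷_; map; filterᵇ; upTo; take; foldr; length)
open import Data.Maybe using (Maybe; just; nothing)
open import Algebra.Bundles using (CommutativeSemiring)

-- Steps of a lattice path: U = (1,1), D = (1,-1).
data Step : Set where
  U D : Step

words : ℕ → List (List Step)
words zero    = [] ∷ []
words (suc k) = map (U ∷_) (words k) Data.List.++ map (D ∷_) (words k)

dyckFrom : ℕ → List Step → Bool
dyckFrom zero    []      = true
dyckFrom (suc h) []      = false
dyckFrom h       (U ∷ w) = dyckFrom (suc h) w
dyckFrom zero    (D ∷ w) = false
dyckFrom (suc h) (D ∷ w) = dyckFrom h w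

isDyck : List Step → Bool
isDyck = dyckFrom 0

dyckPaths : ℕ → List (List Step)
dyckPaths n = filterᵇ isDyck (words (2 * n))

countU countD : List Step → ℕ
countU []      = 0
countU (U ∷ w) = suc (countU w)
countU (D ∷ w) = countU w
countD []      = 0
countD (U ∷ w) = countD w
countD (D ∷ w) = suc (countD w)

-- height after the first i steps (nonnegative for Dyck words, so ∸ is exact)
height : List Step → ℕ → ℕ
height w i = countU (take i w) ∸ countD (take i w)

-- the letter s_i (1-indexed) of w
letter : List Step → ℕ → Maybe Step
letter []      _             = nothing
letter (s ∷ w) zero          = nothing
letter (s ∷ w) (suc zero)    = just s
letter (s ∷ w) (suc (suc i)) = letter w (suc i)

isU isD : Maybe Step → Bool
isU (just U) = true
isU _        = false
isD (just D) = true
isD _        = false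

isPeak : List Step → ℕ → Bool
isPeak w i = isU (letter w i) ∧ isD (letter w (suc i))

isValley : List Step → ℕ → Bool
isValley w j = isD (letter w j) ∧ isU (letter w (suc j))

sumPos : List Step → (ℕ → ℕ) → ℕ
sumPos w f = foldr _+_ 0 (map (λ i → f (suc i)) (upTo (length w)))

npeaks : List Step → ℕ
npeaks w = sumPos w (λ i → if isPeak w i then 1 else 0)

speaks : List Step → ℕ
speaks w = sumPos w (λ i → if isPeak w i then height w i ∸ 1 else 0)

des : List Step → ℕ
des w = sumPos w (λ j → if isValley w j then 1 else 0)

-- largest x < j with height w x ≡ h (searching downward from j-1; 0 if none)
lastAt : List Step → ℕ → ℕ → ℕ
lastAt w h zero    = 0
lastAt w h (suc x) = if height w x ≡ᵇ h then x else lastAt w h x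

-- semilength of the tunnel of the valley whose lowest point is (j, height w j)
tunnel : List Step → ℕ → ℕ
tunnel w j = (j ∸ lastAt w (height w j) j) / 2

stunnels : List Step → ℕ
stunnels w = sumPos w (λ j → if isValley w j then tunnel w j else 0)

module _ {c ℓ : Level} (R : CommutativeSemiring c ℓ) where
  open CommutativeSemiring R using (Carrier; 1#; 0#) renaming (_*_ to _*R_; _+_ to _+R_)

  pow : Carrier → ℕ → Carrier
  pow x zero    = 1#
  pow x (suc k) = x *R pow x k

  sumR : List Carrier → Carrier
  sumR = foldr _+R_ 0#

module Submission where

open import Defs
open import Level using (Level)
open import Data.Nat using (ℕ; _≥_; _∸_)
open import Data.List using (map)
open import Algebra.Bundles using (CommutativeSemiring)

-- Both sides of the identity are compared with the Stieltjes continued fraction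
-- with coefficients t, q, qt, q², q²t, …, i.e. with L t n = Σ_{P ∈ 𝒟ₙ} Π λ(h),
-- the product over the up-steps of P ending at height h, λ(2k+1) = qᵏt, λ(2k+2) = qᵏ⁺¹.

module Paths where
  open import Data.Nat using (zero; suc; _+_; _*_; _≤_; _<_; z≤n; s≤s; s≤s⁻¹; _≡ᵇ_; _/_; _<?_; _≤?_; _≟_)
  open import Data.Nat.Properties
  open import Data.Nat.DivMod using (m*n/n≡m)
  open import Data.Bool using (Bool; true; false; _∧_; if_then_else_; T)
  open import Data.List using (List; []; _∷_; _++_; length; take; foldr; applyUpTo)
  open import Data.List.Properties using (length-++)
  open import Data.Maybe using (Maybe; just; nothing)
  open import Data.Product using (Σ; _×_; _,_)
  open import Data.Sum using (_⊎_; inj₁; inj₂)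
  open import Data.Empty using (⊥-elim)
  open import Relation.Nullary using (yes; no)
  open import Relation.Binary.PropositionalEquality
  open import Algebra.Properties.CommutativeSemigroup +-commutativeSemigroup using (interchange)

  sum< : ℕ → (ℕ → ℕ) → ℕ
  sum< zero    f = 0
  sum< (suc n) f = f 0 + sum< n (λ i → f (suc i))

  sumPos≡sum< : ∀ w f → sumPos w f ≡ sum< (length w) (λ i → f (suc i))
  sumPos≡sum< w f = unfold (λ i → f (suc i)) (λ i → i) (length w)
    where
    unfold : ∀ g h n → foldr _+_ 0 (map g (applyUpTo h n)) ≡ sum< n (λ i → g (h i))
    unfold g h zero    = refl
    unfold g h (suc n) = cong (g (h 0) +_) (unfold g (λ i → h (suc i)) n)

  sum<-cong : ∀ n {f g : ℕ → ℕ} → (∀ i → i < n → f i ≡ g i) → sum< n f ≡ sum< n g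
  sum<-cong zero    f≡g = refl
  sum<-cong (suc n) f≡g = cong₂ _+_ (f≡g 0 (s≤s z≤n)) (sum<-cong n (λ i i<n → f≡g (suc i) (s≤s i<n)))

  sum<-split : ∀ m n f → sum< (m + n) f ≡ sum< m f + sum< n (λ i → f (i + m))
  sum<-split zero    n f = sum<-cong n (λ i _ → cong f (sym (+-identityʳ i)))
  sum<-split (suc m) n f = begin
    f 0 + sum< (m + n) (λ i → f (suc i))
      ≡⟨ cong (f 0 +_) (sum<-split m n (λ i → f (suc i))) ⟩
    f 0 + (sum< m (λ i → f (suc i)) + sum< n (λ i → f (suc (i + m))))
      ≡⟨ cong (λ x → f 0 + (sum< m (λ i → f (suc i)) + x)) (sum<-cong n (λ i _ → cong f (sym (+-suc i m)))) ⟩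
    f 0 + (sum< m (λ i → f (suc i)) + sum< n (λ i → f (i + suc m)))
      ≡⟨ sym (+-assoc (f 0) _ _) ⟩
    sum< (suc m) f + sum< n (λ i → f (i + suc m)) ∎
    where open ≡-Reasoning

  sum<-+ : ∀ n f g → sum< n (λ i → f i + g i) ≡ sum< n f + sum< n g
  sum<-+ zero    f g = refl
  sum<-+ (suc n) f g = trans (cong (f 0 + g 0 +_) (sum<-+ n (λ i → f (suc i)) (λ i → g (suc i))))
                             (interchange (f 0) (g 0) _ _)

  letter-++ˡ : ∀ x y i → suc i ≤ length x → letter (x ++ y) (suc i) ≡ letter x (suc i)
  letter-++ˡ (s ∷ x) y zero    _        = refl
  letter-++ˡ (s ∷ x) y (suc i) (s≤s le) = letter-++ˡ x y i le

  letter-++ʳ : ∀ x y j → letter (x ++ y) (suc (j + length x)) ≡ letter y (suc j)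
  letter-++ʳ []      y j = cong (λ k → letter y (suc k)) (+-identityʳ j)
  letter-++ʳ (s ∷ x) y j rewrite +-suc j (length x) = letter-++ʳ x y j

  letter-beyond : ∀ x i → length x ≤ i → letter x (suc i) ≡ nothing
  letter-beyond []           i       _        = refl
  letter-beyond (s ∷ [])     (suc i) _        = refl
  letter-beyond (s ∷ s' ∷ x) (suc i) (s≤s le) = letter-beyond (s' ∷ x) i le

  take-++ˡ : ∀ (x y : List Step) i → i ≤ length x → take i (x ++ y) ≡ take i x
  take-++ˡ x       y zero    _        = refl
  take-++ˡ (s ∷ x) y (suc i) (s≤s le) = cong (s ∷_) (take-++ˡ x y i le)

  take-++ʳ : ∀ (x y : List Step) k → take (k + length x) (x ++ y) ≡ x ++ take k y
  take-++ʳ []      y k = cong (λ j → take j y) (+-identityʳ k)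
  take-++ʳ (s ∷ x) y k rewrite +-suc k (length x) = cong (s ∷_) (take-++ʳ x y k)

  countU-++ : ∀ x y → countU (x ++ y) ≡ countU x + countU y
  countU-++ []      y = refl
  countU-++ (U ∷ x) y = cong suc (countU-++ x y)
  countU-++ (D ∷ x) y = countU-++ x y

  countD-++ : ∀ x y → countD (x ++ y) ≡ countD x + countD y
  countD-++ []      y = refl
  countD-++ (U ∷ x) y = countD-++ x y
  countD-++ (D ∷ x) y = cong suc (countD-++ x y)

  length≡countU+countD : ∀ w → length w ≡ countU w + countD w
  length≡countU+countD []      = refl
  length≡countU+countD (U ∷ w) = cong suc (length≡countU+countD w)
  length≡countU+countD (D ∷ w) = trans (cong suc (length≡countU+countD w)) (sym (+-suc (countU w) (countD w)))

  take-suc : ∀ (w : List Step) p →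
    (letter w (suc p) ≡ nothing × take (suc p) w ≡ take p w) ⊎
    (Σ Step λ s → letter w (suc p) ≡ just s × take (suc p) w ≡ take p w ++ (s ∷ []))
  take-suc []      zero    = inj₁ (refl , refl)
  take-suc []      (suc p) = inj₁ (refl , refl)
  take-suc (s ∷ w) zero    = inj₂ (s , refl , refl)
  take-suc (s ∷ w) (suc p) with take-suc w p
  ... | inj₁ (e₁ , e₂)      = inj₁ (e₁ , cong (s ∷_) e₂)
  ... | inj₂ (s' , e₁ , e₂) = inj₂ (s' , e₁ , cong (s ∷_) e₂)

  -- Heights move by at most one step upwards, so they cannot jump over a level.

  suc∸≤ : ∀ m n → suc m ∸ n ≤ suc (m ∸ n)
  suc∸≤ m       zero    = ≤-refl
  suc∸≤ zero    (suc n) = subst (_≤ 1) (sym (0∸n≡0 n)) z≤n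
  suc∸≤ (suc m) (suc n) = suc∸≤ m n

  height-suc≤ : ∀ w p → height w (suc p) ≤ suc (height w p)
  height-suc≤ w p with take-suc w p
  ... | inj₁ (_ , e) rewrite e = n≤1+n _
  ... | inj₂ (U , _ , e) rewrite e | countU-++ (take p w) (U ∷ []) | countD-++ (take p w) (U ∷ [])
         | +-identityʳ (countD (take p w)) | +-comm (countU (take p w)) 1 =
    suc∸≤ (countU (take p w)) (countD (take p w))
  ... | inj₂ (D , _ , e) rewrite e | countU-++ (take p w) (D ∷ []) | countD-++ (take p w) (D ∷ [])
         | +-identityʳ (countU (take p w)) | +-comm (countD (take p w)) 1 =
    ≤-trans (∸-monoʳ-≤ (countU (take p w)) (n≤1+n (countD (take p w)))) (n≤1+n _)

  visits-below : ∀ w i h → h < height w i → Σ ℕ λ p → p < i × height w p ≡ h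
  visits-below w zero    h ()
  visits-below w (suc i) h h<hᵢ with h <? height w i
  ... | yes h< = let (p , p<i , e) = visits-below w i h h< in p , ≤-trans p<i (n≤1+n i) , e
  ... | no h≮ = i , ≤-refl , ≤-antisym (≮⇒≥ h≮) (s≤s⁻¹ (≤-trans h<hᵢ (height-suc≤ w i)))

  dyck-prefix : ∀ h w → dyckFrom h w ≡ true → ∀ i → countD (take i w) ≤ h + countU (take i w)
  dyck-prefix h       w       e zero    = z≤n
  dyck-prefix h       []      e (suc i) = z≤n
  dyck-prefix zero    (U ∷ w) e (suc i) = subst (countD (take i w) ≤_) (sym (+-suc 0 _)) (dyck-prefix 1 w e i)
  dyck-prefix (suc h) (U ∷ w) e (suc i) = subst (countD (take i w) ≤_) (sym (+-suc (suc h) _)) (dyck-prefix (suc (suc h)) w e i)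
  dyck-prefix zero    (D ∷ w) () (suc i)
  dyck-prefix (suc h) (D ∷ w) e (suc i) = s≤s (dyck-prefix h w e i)

  dyck-end : ∀ h w → dyckFrom h w ≡ true → countD w ≡ h + countU w
  dyck-end zero    []      e  = refl
  dyck-end (suc h) []      ()
  dyck-end zero    (U ∷ w) e  = dyck-end 1 w e
  dyck-end (suc h) (U ∷ w) e  = trans (dyck-end (suc (suc h)) w e) (sym (+-suc (suc h) _))
  dyck-end zero    (D ∷ w) ()
  dyck-end (suc h) (D ∷ w) e  = cong suc (dyck-end h w e)

  dyck-last : ∀ h x → dyckFrom h x ≡ true → ∀ i → suc i ≡ length x → letter x (suc i) ≡ just D
  dyck-last zero    (U ∷ [])     () zero refl
  dyck-last (suc h) (U ∷ [])     () zero refl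
  dyck-last h       (D ∷ [])     e  zero refl = refl
  dyck-last h       (s ∷ s' ∷ x) e  zero ()
  dyck-last h       (s ∷ [])     e  (suc i) ()
  dyck-last zero    (U ∷ s' ∷ x) e  (suc i) eq = dyck-last 1 (s' ∷ x) e i (suc-injective eq)
  dyck-last (suc h) (U ∷ s' ∷ x) e  (suc i) eq = dyck-last (suc (suc h)) (s' ∷ x) e i (suc-injective eq)
  dyck-last zero    (D ∷ s' ∷ x) () (suc i) eq
  dyck-last (suc h) (D ∷ s' ∷ x) e  (suc i) eq = dyck-last h (s' ∷ x) e i (suc-injective eq)

  dyck-first : ∀ s x → isDyck (s ∷ x) ≡ true → s ≡ U
  dyck-first U x e = refl

  ind : Bool → ℕ
  ind b = if b then 1 else 0

  peakAt peakHeightAt valleyAt tunnelAt : List Step → ℕ → ℕ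
  peakAt       w i = ind (isPeak w i)
  peakHeightAt w i = if isPeak w i then height w i ∸ 1 else 0
  valleyAt     w i = ind (isValley w i)
  tunnelAt     w i = if isValley w i then tunnel w i else 0

  semilength≡countU : ∀ A a → isDyck A ≡ true → length A ≡ 2 * a → countU A ≡ a
  semilength≡countU A a d l = *-cancelˡ-≡ (countU A) a 2 (begin
    2 * countU A              ≡⟨ cong (countU A +_) (+-identityʳ (countU A)) ⟩
    countU A + countU A       ≡⟨ cong (countU A +_) (sym (dyck-end 0 A d)) ⟩
    countU A + countD A       ≡⟨ sym (length≡countU+countD A) ⟩
    length A                  ≡⟨ l ⟩
    2 * a                     ∎)
    where open ≡-Reasoning

  des-cons : ∀ s w → des (s ∷ w) ≡ valleyAt (s ∷ w) 1 + des w
  des-cons s w = trans (sumPos≡sum< (s ∷ w) (valleyAt (s ∷ w))) (cong (valleyAt (s ∷ w) 1 +_) (sym (sumPos≡sum< w (valleyAt w))))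

  -- Each valley is followed by an up-step, and a word starting with U has one more such up-step.
  des+startsU≤countU : ∀ w → des w + ind (isU (letter w 1)) ≤ countU w
  des+startsU≤countU []      = z≤n
  des+startsU≤countU (U ∷ w) rewrite des-cons U w =
    subst (_≤ suc (countU w)) (+-comm 1 (des w)) (s≤s (≤-trans (m≤m+n (des w) _) (des+startsU≤countU w)))
  des+startsU≤countU (D ∷ w) rewrite des-cons D w | +-identityʳ (ind (isU (letter w 1)) + des w) =
    subst (_≤ countU w) (+-comm (des w) _) (des+startsU≤countU w)

  des≤semilength : ∀ A a → isDyck A ≡ true → length A ≡ 2 * a → des A ≤ a
  des≤semilength A a d l =
    ≤-trans (≤-trans (m≤m+n (des A) _) (des+startsU≤countU A)) (≤-reflexive (semilength≡countU A a d l))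

  isD⇒D : ∀ m → isD m ≡ true → m ≡ just D
  isD⇒D (just D) e = refl

  isU⇒U : ∀ m → isU m ≡ true → m ≡ just U
  isU⇒U (just U) e = refl

  ∧-trueˡ : ∀ a b → a ∧ b ≡ true → a ≡ true
  ∧-trueˡ true b _ = refl

  height-before-D : ∀ w p → isDyck w ≡ true → letter w (suc p) ≡ just D →
    height w p ≡ suc (height w (suc p))
  height-before-D w p dw eL with take-suc w p | dyck-prefix 0 w dw (suc p)
  ... | inj₁ (e₁ , _) | _ with () ← trans (sym e₁) eL
  ... | inj₂ (s , e₁ , e₂) | pre with refl ← trans (sym e₁) eL
    rewrite e₂ | countU-++ (take p w) (D ∷ []) | countD-++ (take p w) (D ∷ [])
          | +-identityʳ (countU (take p w)) | +-comm (countD (take p w)) 1 = +-∸-assoc 1 pre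

  height-after-U : ∀ w p → isDyck w ≡ true → letter w (suc p) ≡ just U → 1 ≤ height w (suc p)
  height-after-U w p dw eL with take-suc w p | dyck-prefix 0 w dw p
  ... | inj₁ (e₁ , _) | _ with () ← trans (sym e₁) eL
  ... | inj₂ (s , e₁ , e₂) | pre with refl ← trans (sym e₁) eL
    rewrite e₂ | countU-++ (take p w) (U ∷ []) | countD-++ (take p w) (U ∷ [])
          | +-identityʳ (countD (take p w)) | +-comm (countU (take p w)) 1 =
    subst (1 ≤_) (sym (+-∸-assoc 1 pre)) (s≤s z≤n)

  -- The level of the bottom point of a valley was visited before: its tunnel exists.
  valley-level-visited : ∀ w j → isDyck w ≡ true → isValley w (suc j) ≡ true →
    Σ ℕ λ p → p < suc j × height w p ≡ height w (suc j)
  valley-level-visited w j dw valley =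
    let h = height w (suc j)
        (p , p<j , e) = visits-below w j h (subst (h <_) (sym (height-before-D w j dw (isD⇒D _ (∧-trueˡ _ _ valley)))) ≤-refl)
    in p , ≤-trans p<j (n≤1+n j) , e

  lastAt-shift : ∀ (W A : List Step) (k hW hA j : ℕ) →
    (∀ p → p < j → (height W (k + p) ≡ᵇ hW) ≡ (height A p ≡ᵇ hA)) →
    (Σ ℕ λ p → p < j × height A p ≡ hA) →
    lastAt W hW (k + j) ≡ k + lastAt A hA j
  lastAt-shift W A k hW hA zero    same (p , () , _)
  lastAt-shift W A k hW hA (suc j) same (p , p<j , e) rewrite +-suc k j | same j ≤-refl
    with height A j ≡ᵇ hA in eqb
  ... | true = refl
  ... | false with p ≟ j
  ...   | yes refl = ⊥-elim (subst T eqb (≡⇒≡ᵇ (height A p) hA e))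
  ...   | no p≢j   = lastAt-shift W A k hW hA j (λ p' p'< → same p' (≤-trans p'< (n≤1+n j)))
                       (p , ≤∧≢⇒< (s≤s⁻¹ p<j) p≢j , e)

  lastAt-unvisited : ∀ W h j → (∀ p → p < j → (height W (suc p) ≡ᵇ h) ≡ false) → lastAt W h (suc j) ≡ 0
  lastAt-unvisited W h zero    _ with height W 0 ≡ᵇ h
  ... | true  = refl
  ... | false = refl
  lastAt-unvisited W h (suc j) unvisited rewrite unvisited j ≤-refl =
    lastAt-unvisited W h j (λ p p< → unvisited p (≤-trans p< (n≤1+n j)))

  isEmpty isNonEmpty : List Step → ℕ
  isEmpty []      = 1
  isEmpty (_ ∷ _) = 0
  isNonEmpty []      = 0
  isNonEmpty (_ ∷ _) = 1

  whenNonEmpty : List Step → ℕ → ℕ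
  whenNonEmpty []      _ = 0
  whenNonEmpty (_ ∷ _) v = v

  -- The statistics of P = U A D B in terms of those of the Dyck paths A and B:
  -- the peaks of A are raised by one, the valleys of A and B keep their tunnels,
  -- and the new valley at the junction (present iff B ≠ []) has the tunnel U A D.
  module FirstReturn (A B : List Step) (dA : isDyck A ≡ true) (dB : isDyck B ≡ true) where

    W : List Step
    W = U ∷ A ++ D ∷ B

    -- positions of W: 1 (the first U), 2 … |A|+1 (A), |A|+2 (the D), then B
    posD : ℕ
    posD = suc (suc (length A))

    sumPos-W : ∀ f gA gB →
      (∀ i → suc i ≤ length A → f (suc (suc i)) ≡ gA (suc i)) →
      (∀ j → f (suc (suc (suc j + length A))) ≡ gB (suc j)) →
      sumPos W f ≡ f 1 + sumPos A gA + (f posD + sumPos B gB)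
    sumPos-W f gA gB onA onB = begin
      sumPos W f
        ≡⟨ sumPos≡sum< W f ⟩
      f 1 + sum< (length (A ++ D ∷ B)) (λ i → f (suc (suc i)))
        ≡⟨ cong (λ m → f 1 + sum< m (λ i → f (suc (suc i)))) (length-++ A) ⟩
      f 1 + sum< (length A + suc (length B)) (λ i → f (suc (suc i)))
        ≡⟨ cong (f 1 +_) (sum<-split (length A) (suc (length B)) (λ i → f (suc (suc i)))) ⟩
      f 1 + (sum< (length A) (λ i → f (suc (suc i))) + (f posD + sum< (length B) (λ j → f (suc (suc (suc j + length A))))))
        ≡⟨ cong₂ (λ x y → f 1 + (x + (f posD + y)))
             (trans (sum<-cong (length A) onA) (sym (sumPos≡sum< A gA)))
             (trans (sum<-cong (length B) (λ j _ → onB j)) (sym (sumPos≡sum< B gB))) ⟩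
      f 1 + (sumPos A gA + (f posD + sumPos B gB))
        ≡⟨ sym (+-assoc (f 1) _ _) ⟩
      f 1 + sumPos A gA + (f posD + sumPos B gB) ∎
      where open ≡-Reasoning

    letter-inA : ∀ i → suc i ≤ length A → letter W (suc (suc i)) ≡ letter A (suc i)
    letter-inA i le = letter-++ˡ A (D ∷ B) i le

    letter-inB : ∀ x → letter W (suc (suc (x + length A))) ≡ letter (D ∷ B) (suc x)
    letter-inB x = letter-++ʳ A (D ∷ B) x

    -- A two-letter pattern that does not distinguish "D then D" from "D then end"
    -- is read in A exactly as in W: the last letter of A is a D.
    pattern-inA : (f : Maybe Step → Maybe Step → Bool) → f (just D) (just D) ≡ f (just D) nothing →
      ∀ i → suc i ≤ length A →
      f (letter W (suc (suc i))) (letter W (suc (suc (suc i)))) ≡ f (letter A (suc i)) (letter A (suc (suc i)))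
    pattern-inA f DD≡Dend i le with suc (suc i) ≤? length A
    ... | yes le₂ = cong₂ f (letter-inA i le) (letter-inA (suc i) le₂)
    ... | no  nle = begin
      f (letter W (suc (suc i))) (letter W (suc (suc (suc i))))
        ≡⟨ cong₂ f (trans (letter-inA i le) lastA) (subst (λ k → letter W (suc (suc k)) ≡ just D) (sym last) (letter-inB 0)) ⟩
      f (just D) (just D)
        ≡⟨ DD≡Dend ⟩
      f (just D) nothing
        ≡⟨ sym (cong₂ f lastA (subst (λ k → letter A (suc k) ≡ nothing) (sym last) (letter-beyond A (length A) ≤-refl))) ⟩
      f (letter A (suc i)) (letter A (suc (suc i))) ∎
      where
      open ≡-Reasoning
      last : suc i ≡ length A
      last = ≤-antisym le (s≤s⁻¹ (≰⇒> nle))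
      lastA : letter A (suc i) ≡ just D
      lastA = dyck-last 0 A dA i last

    pattern-inB : (f : Maybe Step → Maybe Step → Bool) →
      ∀ j → f (letter W (suc (suc (suc j + length A)))) (letter W (suc (suc (suc (suc j + length A)))))
          ≡ f (letter B (suc j)) (letter B (suc (suc j)))
    pattern-inB f j = cong₂ f (letter-inB (suc j)) (letter-inB (suc (suc j)))

    peak-inA : ∀ i → suc i ≤ length A → isPeak W (suc (suc i)) ≡ isPeak A (suc i)
    peak-inA = pattern-inA (λ a b → isU a ∧ isD b) refl

    valley-inA : ∀ i → suc i ≤ length A → isValley W (suc (suc i)) ≡ isValley A (suc i)
    valley-inA = pattern-inA (λ a b → isD a ∧ isU b) refl

    peak-inB : ∀ j → isPeak W (suc (suc (suc j + length A))) ≡ isPeak B (suc j)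
    peak-inB = pattern-inB (λ a b → isU a ∧ isD b)

    valley-inB : ∀ j → isValley W (suc (suc (suc j + length A))) ≡ isValley B (suc j)
    valley-inB = pattern-inB (λ a b → isD a ∧ isU b)

    no-peak-at-posD : isPeak W posD ≡ false
    no-peak-at-posD = cong (λ a → isU a ∧ isD (letter W (suc posD))) (letter-inB 0)

    valley-at-posD : isValley W posD ≡ isU (letter B 1)
    valley-at-posD = cong₂ (λ a b → isD a ∧ isU b) (letter-inB 0) (letter-inB 1)

    height-inA : ∀ p → p ≤ length A → height W (suc p) ≡ suc (height A p)
    height-inA p le rewrite take-++ˡ A (D ∷ B) p le = +-∸-assoc 1 (dyck-prefix 0 A dA p)

    height-inB : ∀ x → height W (suc (suc (x + length A))) ≡ height B x
    height-inB x rewrite take-++ʳ A (D ∷ B) (suc x) | countU-++ A (D ∷ take x B) | countD-++ A (D ∷ take x B)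
      | dyck-end 0 A dA | +-suc (countU A) (countD (take x B)) =
      [m+n]∸[m+o]≡n∸o (countU A) (countU (take x B)) (countD (take x B))

    npeaks-W : npeaks W ≡ isEmpty A + npeaks A + npeaks B
    npeaks-W = trans (sumPos-W (peakAt W) (peakAt A) (peakAt B)
                               (λ i le → cong ind (peak-inA i le)) (λ j → cong ind (peak-inB j)))
                     (cong₂ (λ x y → x + npeaks A + (y + npeaks B)) (first A dA) (cong ind no-peak-at-posD))
      where
      first : ∀ A → isDyck A ≡ true → peakAt (U ∷ A ++ D ∷ B) 1 ≡ isEmpty A
      first []      _ = refl
      first (s ∷ A) d rewrite dyck-first s A d = refl

    -- The peaks of A gain one level each.
    speaks-W : speaks W ≡ speaks A + npeaks A + speaks B
    speaks-W = trans (sumPos-W (peakHeightAt W) raised (peakHeightAt B) onA onB)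
                     (trans (cong₂ (λ x y → x + sumPos A raised + (y + speaks B))
                                   (if-same (isPeak W 1)) (cong (λ b → if b then height W posD ∸ 1 else 0) no-peak-at-posD))
                            (cong (_+ speaks B) split-raised))
      where
      raised : ℕ → ℕ
      raised i = peakHeightAt A i + peakAt A i
      onA : ∀ i → suc i ≤ length A → peakHeightAt W (suc (suc i)) ≡ raised (suc i)
      onA i le rewrite peak-inA i le | height-inA (suc i) le with isPeak A (suc i) in peak
      ... | false = refl
      ... | true  = sym (trans (+-comm (height A (suc i) ∸ 1) 1)
                      (m+[n∸m]≡n (height-after-U A i dA (isU⇒U _ (∧-trueˡ _ _ peak)))))
      onB : ∀ j → peakHeightAt W (suc (suc (suc j + length A))) ≡ peakHeightAt B (suc j)
      onB j = cong₂ (λ b h → if b then h ∸ 1 else 0) (peak-inB j) (height-inB (suc j))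
      if-same : ∀ b → (if b then 0 else 0) ≡ 0
      if-same true  = refl
      if-same false = refl
      split-raised : sumPos A raised ≡ speaks A + npeaks A
      split-raised = begin
        sumPos A raised
          ≡⟨ sumPos≡sum< A raised ⟩
        sum< (length A) (λ i → peakHeightAt A (suc i) + peakAt A (suc i))
          ≡⟨ sum<-+ (length A) (λ i → peakHeightAt A (suc i)) (λ i → peakAt A (suc i)) ⟩
        sum< (length A) (λ i → peakHeightAt A (suc i)) + sum< (length A) (λ i → peakAt A (suc i))
          ≡⟨ sym (cong₂ _+_ (sumPos≡sum< A (peakHeightAt A)) (sumPos≡sum< A (peakAt A))) ⟩
        speaks A + npeaks A ∎
        where open ≡-Reasoning

    -- The junction is a valley iff B ≠ [].
    des-W : des W ≡ des A + (isNonEmpty B + des B)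
    des-W = trans (sumPos-W (valleyAt W) (valleyAt A) (valleyAt B)
                            (λ i le → cong ind (valley-inA i le)) (λ j → cong ind (valley-inB j)))
                  (cong (λ x → des A + (x + des B)) (trans (cong ind valley-at-posD) (junction B dB)))
      where
      junction : ∀ B → isDyck B ≡ true → ind (isU (letter B 1)) ≡ isNonEmpty B
      junction []      _ = refl
      junction (s ∷ B) d rewrite dyck-first s B d = refl

    -- Tunnels: a valley of A or B finds its tunnel inside A resp. B, and the
    -- junction valley returns to level 0 only at position 0.

    tunnel-inA : ∀ i → suc i ≤ length A → tunnelAt W (suc (suc i)) ≡ tunnelAt A (suc i)
    tunnel-inA i le rewrite valley-inA i le with isValley A (suc i) in valley
    ... | false = refl
    ... | true  = cong (λ x → (suc (suc i) ∸ x) / 2)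
                    (trans (cong (λ h → lastAt W h (suc (suc i))) (height-inA (suc i) le)) shifted)
      where
      h = height A (suc i)
      shifted : lastAt W (suc h) (1 + suc i) ≡ 1 + lastAt A h (suc i)
      shifted = lastAt-shift W A 1 (suc h) h (suc i)
        (λ p p< → cong (_≡ᵇ suc h) (height-inA p (≤-trans (s≤s⁻¹ p<) (≤-trans (n≤1+n i) le))))
        (valley-level-visited A i dA valley)

    tunnel-at-posD : tunnelAt W posD ≡ whenNonEmpty B (posD / 2)
    tunnel-at-posD rewrite valley-at-posD = junction B dB
      where
      tunnel≡ : tunnel W posD ≡ posD / 2
      tunnel≡ = cong (λ x → (posD ∸ x) / 2)
        (trans (cong (λ h → lastAt W h posD) (height-inB 0))
               (lastAt-unvisited W 0 (suc (length A)) (λ p p< → cong (_≡ᵇ 0) (height-inA p (s≤s⁻¹ p<)))))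
      junction : ∀ B' → isDyck B' ≡ true → (if isU (letter B' 1) then tunnel W posD else 0) ≡ whenNonEmpty B' (posD / 2)
      junction []       _ = refl
      junction (s ∷ B') d rewrite dyck-first s B' d = tunnel≡

    tunnel-inB : ∀ j → tunnelAt W (suc (suc (suc j + length A))) ≡ tunnelAt B (suc j)
    tunnel-inB j rewrite valley-inB j with isValley B (suc j) in valley
    ... | false = refl
    ... | true  = begin
      (pos ∸ lastAt W (height W pos) pos) / 2
        ≡⟨ cong (λ x → (pos ∸ lastAt W x pos) / 2) (height-inB (suc j)) ⟩
      (pos ∸ lastAt W h pos) / 2
        ≡⟨ cong (λ x → (x ∸ lastAt W h x) / 2) pos≡ ⟩
      (posD + suc j ∸ lastAt W h (posD + suc j)) / 2
        ≡⟨ cong (λ x → (posD + suc j ∸ x) / 2) shifted ⟩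
      (posD + suc j ∸ (posD + lastAt B h (suc j))) / 2
        ≡⟨ cong (_/ 2) ([m+n]∸[m+o]≡n∸o posD (suc j) (lastAt B h (suc j))) ⟩
      (suc j ∸ lastAt B h (suc j)) / 2 ∎
      where
      open ≡-Reasoning
      pos = suc (suc (suc j + length A))
      h = height B (suc j)
      pos≡ : pos ≡ posD + suc j
      pos≡ = cong (λ x → suc (suc x)) (+-comm (suc j) (length A))
      shifted : lastAt W h (posD + suc j) ≡ posD + lastAt B h (suc j)
      shifted = lastAt-shift W B posD h h (suc j)
        (λ p _ → trans (cong (λ x → height W (suc (suc x)) ≡ᵇ h) (+-comm (length A) p)) (cong (_≡ᵇ h) (height-inB p)))
        (valley-level-visited B j dB valley)

    stunnels-W : stunnels W ≡ stunnels A + (whenNonEmpty B (posD / 2) + stunnels B)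
    stunnels-W = trans (sumPos-W (tunnelAt W) (tunnelAt A) (tunnelAt B) tunnel-inA tunnel-inB)
                       (cong (λ x → stunnels A + (x + stunnels B)) tunnel-at-posD)

  -- The tunnel of the junction valley of U A D B has semilength a+1 when |A| = 2a.
  half-suc-suc-double : ∀ a → suc (suc (2 * a)) / 2 ≡ suc a
  half-suc-suc-double a = trans (cong (λ k → suc (suc k) / 2) (*-comm 2 a)) (m*n/n≡m (suc a) 2)

module PathSums {c ℓ : Level} (R : CommutativeSemiring c ℓ) where
  open import Data.Nat as ℕ using (zero; suc; _≤_; _<_; s≤s)
  import Data.Nat.Properties as ℕₚ
  open import Data.Nat.Induction using (<-rec)
  open import Level using (_⊔_)
  open import Data.Bool using (Bool; true; false; not; T?)
  open import Data.Bool.Properties using (not-involutive)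
  open import Data.List using (List; []; _∷_; _++_; length; filterᵇ)
  open import Data.List.Properties using (map-∘; filter-++; ++-assoc)
  import Relation.Binary.PropositionalEquality as P
  open P using (_≡_)

  open CommutativeSemiring R hiding (zero) renaming (_+_ to _⊕_; _*_ to _⊗_)
  open import Relation.Binary.Reasoning.Setoid setoid
  open import Algebra.Properties.CommutativeSemigroup +-commutativeSemigroup
    using () renaming (interchange to ⊕-interchange)
  open import Algebra.Properties.CommutativeSemigroup *-commutativeSemigroup
    using () renaming (interchange to ⊗-interchange)

  ≡⇒≈ : ∀ {x y} → x ≡ y → x ≈ y
  ≡⇒≈ P.refl = refl

  pow-+ : ∀ x a b → pow R x (a ℕ.+ b) ≈ pow R x a ⊗ pow R x b
  pow-+ x zero    b = sym (*-identityˡ _)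
  pow-+ x (suc a) b = trans (*-congˡ (pow-+ x a b)) (sym (*-assoc x _ _))

  pow-* : ∀ x y a → pow R (x ⊗ y) a ≈ pow R x a ⊗ pow R y a
  pow-* x y zero    = sym (*-identityˡ 1#)
  pow-* x y (suc a) = trans (*-congˡ (pow-* x y a)) (⊗-interchange x y _ _)

  module _ {A : Set} where
    sumOver : (A → Carrier) → List A → Carrier
    sumOver f xs = sumR R (map f xs)

    sumOver-cong : ∀ {f g : A → Carrier} xs → (∀ x → f x ≈ g x) → sumOver f xs ≈ sumOver g xs
    sumOver-cong []       f≈g = refl
    sumOver-cong (x ∷ xs) f≈g = +-cong (f≈g x) (sumOver-cong xs f≈g)

    sumOver-+ : ∀ (f g : A → Carrier) xs → sumOver (λ x → f x ⊕ g x) xs ≈ sumOver f xs ⊕ sumOver g xs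
    sumOver-+ f g []       = sym (+-identityˡ 0#)
    sumOver-+ f g (x ∷ xs) = trans (+-congˡ (sumOver-+ f g xs)) (⊕-interchange (f x) (g x) _ _)

    sumOver-0 : ∀ xs → sumOver (λ _ → 0#) xs ≈ 0#
    sumOver-0 []       = refl
    sumOver-0 (x ∷ xs) = trans (+-identityˡ _) (sumOver-0 xs)

    sumOver-*ˡ : ∀ a (f : A → Carrier) xs → sumOver (λ x → a ⊗ f x) xs ≈ a ⊗ sumOver f xs
    sumOver-*ˡ a f []       = sym (zeroʳ a)
    sumOver-*ˡ a f (x ∷ xs) = trans (+-congˡ (sumOver-*ˡ a f xs)) (sym (distribˡ a _ _))

    sumOver-*ʳ : ∀ a (f : A → Carrier) xs → sumOver (λ x → f x ⊗ a) xs ≈ sumOver f xs ⊗ a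
    sumOver-*ʳ a f xs = trans (sumOver-cong xs (λ x → *-comm (f x) a)) (trans (sumOver-*ˡ a f xs) (*-comm a _))

    sumOver-++ : ∀ (f : A → Carrier) xs ys → sumOver f (xs ++ ys) ≈ sumOver f xs ⊕ sumOver f ys
    sumOver-++ f []       ys = sym (+-identityˡ _)
    sumOver-++ f (x ∷ xs) ys = trans (+-congˡ (sumOver-++ f xs ys)) (sym (+-assoc (f x) _ _))

  ⨁< : ℕ → (ℕ → Carrier) → Carrier
  ⨁< zero    f = 0#
  ⨁< (suc n) f = ⨁< n f ⊕ f n

  ⨁<-cong : ∀ n {f g} → (∀ i → i < n → f i ≈ g i) → ⨁< n f ≈ ⨁< n g
  ⨁<-cong zero    f≈g = refl
  ⨁<-cong (suc n) f≈g = +-cong (⨁<-cong n (λ i i< → f≈g i (ℕₚ.≤-trans i< (ℕₚ.n≤1+n n)))) (f≈g n ℕₚ.≤-refl)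

  ⨁<-length : ∀ {m n} f → m ≡ n → ⨁< m f ≈ ⨁< n f
  ⨁<-length f P.refl = refl

  ⨁<-cons : ∀ n f → ⨁< (suc n) f ≈ f 0 ⊕ ⨁< n (λ i → f (suc i))
  ⨁<-cons zero    f = trans (+-identityˡ _) (sym (+-identityʳ _))
  ⨁<-cons (suc n) f = trans (+-congʳ (⨁<-cons n f)) (+-assoc (f 0) _ _)

  ⨁<-+ : ∀ n f g → ⨁< n (λ i → f i ⊕ g i) ≈ ⨁< n f ⊕ ⨁< n g
  ⨁<-+ zero    f g = sym (+-identityˡ 0#)
  ⨁<-+ (suc n) f g = trans (+-congʳ (⨁<-+ n f g)) (⊕-interchange _ _ _ _)

  ⨁<-0 : ∀ n → ⨁< n (λ _ → 0#) ≈ 0#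
  ⨁<-0 zero    = refl
  ⨁<-0 (suc n) = trans (+-identityʳ _) (⨁<-0 n)

  ⨁<-*ˡ : ∀ n a f → ⨁< n (λ i → a ⊗ f i) ≈ a ⊗ ⨁< n f
  ⨁<-*ˡ zero    a f = sym (zeroʳ a)
  ⨁<-*ˡ (suc n) a f = trans (+-congʳ (⨁<-*ˡ n a f)) (sym (distribˡ a _ _))

  sumOver-⨁< : ∀ {A : Set} (xs : List A) m (g : ℕ → A → Carrier) →
    sumOver (λ x → ⨁< m (λ i → g i x)) xs ≈ ⨁< m (λ i → sumOver (g i) xs)
  sumOver-⨁< xs zero    g = sumOver-0 xs
  sumOver-⨁< xs (suc m) g = trans (sumOver-+ _ (g m) xs) (+-congʳ (sumOver-⨁< xs m g))

  -- Exchanging the order of summation over the triangle {(j, m) : j + m + 1 < n}.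
  triangle : ∀ n (G : ℕ → ℕ → Carrier) →
    ⨁< n (λ i → ⨁< i (λ j → G j (i ∸ suc j))) ≈ ⨁< n (λ j → ⨁< (n ∸ suc j) (G j))
  triangle zero    G = refl
  triangle (suc n) G = begin
    ⨁< n (λ i → ⨁< i (λ j → G j (i ∸ suc j))) ⊕ ⨁< n (λ j → G j (n ∸ suc j))
      ≈⟨ +-congʳ (triangle n G) ⟩
    ⨁< n (λ j → ⨁< (n ∸ suc j) (G j)) ⊕ ⨁< n (λ j → G j (n ∸ suc j))
      ≈⟨ sym (⨁<-+ n (λ j → ⨁< (n ∸ suc j) (G j)) (λ j → G j (n ∸ suc j))) ⟩
    ⨁< n (λ j → ⨁< (suc (n ∸ suc j)) (G j))
      ≈⟨ ⨁<-cong n (λ j j< → ⨁<-length (G j) (P.sym (ℕₚ.+-∸-assoc 1 j<))) ⟩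
    ⨁< n (λ j → ⨁< (n ∸ j) (G j))
      ≈⟨ sym (+-identityʳ _) ⟩
    ⨁< n (λ j → ⨁< (n ∸ j) (G j)) ⊕ 0#
      ≈⟨ +-congˡ (⨁<-length (G n) (P.sym (ℕₚ.n∸n≡0 n))) ⟩
    ⨁< n (λ j → ⨁< (suc n ∸ suc j) (G j)) ⊕ ⨁< (suc n ∸ suc n) (G n) ∎

  sumPaths : ℕ → ℕ → (List Step → Carrier) → Carrier
  sumPaths h k f = sumOver f (filterᵇ (dyckFrom h) (words k))

  sumDyck : ℕ → (List Step → Carrier) → Carrier
  sumDyck n f = sumR R (map f (dyckPaths n))

  sumPathsAfterD : ℕ → ℕ → (List Step → Carrier) → Carrier
  sumPathsAfterD zero    k f = 0#
  sumPathsAfterD (suc h) k f = sumPaths h k (λ w → f (D ∷ w))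

  dyckFrom-U : ∀ h w → dyckFrom h (U ∷ w) ≡ dyckFrom (suc h) w
  dyckFrom-U zero    w = P.refl
  dyckFrom-U (suc h) w = P.refl

  sumOver-map : ∀ {A B : Set} (f : B → Carrier) (g : A → B) xs → sumOver f (map g xs) ≡ sumOver (λ x → f (g x)) xs
  sumOver-map f g xs = P.cong (sumR R) (P.sym (map-∘ xs))

  sumPaths-suc : ∀ h k f → sumPaths h (suc k) f ≈ sumPaths (suc h) k (λ w → f (U ∷ w)) ⊕ sumPathsAfterD h k f
  sumPaths-suc h k f = begin
    sumOver f (filterᵇ (dyckFrom h) (map (U ∷_) (words k) ++ map (D ∷_) (words k)))
      ≡⟨ P.cong (sumOver f) (filter-++ (λ w → T? (dyckFrom h w)) (map (U ∷_) (words k)) (map (D ∷_) (words k))) ⟩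
    sumOver f (startU ++ startD)                             ≈⟨ sumOver-++ f startU startD ⟩
    sumOver f startU ⊕ sumOver f startD                      ≈⟨ +-cong (≡⇒≈ sumU) (afterD h) ⟩
    sumPaths (suc h) k (λ w → f (U ∷ w)) ⊕ sumPathsAfterD h k f ∎
    where
    startU startD : List (List Step)
    startU = filterᵇ (dyckFrom h) (map (U ∷_) (words k))
    startD = filterᵇ (dyckFrom h) (map (D ∷_) (words k))

    keepU : ∀ ws → filterᵇ (dyckFrom h) (map (U ∷_) ws) ≡ map (U ∷_) (filterᵇ (dyckFrom (suc h)) ws)
    keepU []       = P.refl
    keepU (w ∷ ws) rewrite dyckFrom-U h w with dyckFrom (suc h) w
    ... | true  = P.cong ((U ∷ w) ∷_) (keepU ws)
    ... | false = keepU ws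

    sumU : sumOver f startU ≡ sumPaths (suc h) k (λ w → f (U ∷ w))
    sumU = P.trans (P.cong (sumOver f) (keepU (words k))) (sumOver-map f (U ∷_) (filterᵇ (dyckFrom (suc h)) (words k)))

    keepD : ∀ h ws → filterᵇ (dyckFrom (suc h)) (map (D ∷_) ws) ≡ map (D ∷_) (filterᵇ (dyckFrom h) ws)
    keepD h []       = P.refl
    keepD h (w ∷ ws) with dyckFrom h w
    ... | true  = P.cong ((D ∷ w) ∷_) (keepD h ws)
    ... | false = keepD h ws

    dropD : ∀ ws → filterᵇ (dyckFrom 0) (map (D ∷_) ws) ≡ []
    dropD []       = P.refl
    dropD (w ∷ ws) = dropD ws

    afterD : ∀ h → sumOver f (filterᵇ (dyckFrom h) (map (D ∷_) (words k))) ≈ sumPathsAfterD h k f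
    afterD zero    = ≡⇒≈ (P.cong (sumOver f) (dropD (words k)))
    afterD (suc h) = ≡⇒≈ (P.trans (P.cong (sumOver f) (keepD h (words k)))
                                  (sumOver-map f (D ∷_) (filterᵇ (dyckFrom h) (words k))))

  sumPaths-cong : ∀ h k {f g} → (∀ w → f w ≈ g w) → sumPaths h k f ≈ sumPaths h k g
  sumPaths-cong h k f≈g = sumOver-cong (filterᵇ (dyckFrom h) (words k)) f≈g

  sumPaths-cong-on : ∀ k h {f g} → (∀ w → dyckFrom h w ≡ true → length w ≡ k → f w ≈ g w) →
    sumPaths h k f ≈ sumPaths h k g
  sumPaths-cong-on zero    zero    f≈g = +-cong (f≈g [] P.refl P.refl) refl
  sumPaths-cong-on zero    (suc h) f≈g = refl
  sumPaths-cong-on (suc k) h {f} {g} f≈g = begin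
    sumPaths h (suc k) f                                         ≈⟨ sumPaths-suc h k f ⟩
    sumPaths (suc h) k (λ w → f (U ∷ w)) ⊕ sumPathsAfterD h k f
      ≈⟨ +-cong (sumPaths-cong-on k (suc h) (λ w d l → f≈g (U ∷ w) (P.trans (dyckFrom-U h w) d) (P.cong suc l)))
                (afterD h f≈g) ⟩
    sumPaths (suc h) k (λ w → g (U ∷ w)) ⊕ sumPathsAfterD h k g ≈⟨ sym (sumPaths-suc h k g) ⟩
    sumPaths h (suc k) g                                         ∎
    where
    afterD : ∀ h → (∀ w → dyckFrom h w ≡ true → length w ≡ suc k → f w ≈ g w) →
      sumPathsAfterD h k f ≈ sumPathsAfterD h k g
    afterD zero    _   = refl
    afterD (suc h) f≈g = sumPaths-cong-on k h (λ w d l → f≈g (D ∷ w) d (P.cong suc l))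

  sumPaths-⨁< : ∀ h k m (g : ℕ → List Step → Carrier) →
    sumPaths h k (λ w → ⨁< m (λ i → g i w)) ≈ ⨁< m (λ i → sumPaths h k (g i))
  sumPaths-⨁< h k m g = sumOver-⨁< (filterᵇ (dyckFrom h) (words k)) m g

  -- A word of length m from height h+1 is cut at its first visit to level h:
  -- w = A D w' with A a Dyck word of some length i < m.
  FirstVisit : ℕ → Set (c ⊔ ℓ)
  FirstVisit m = ∀ h f →
    sumPaths (suc h) m f ≈ ⨁< m (λ i → sumPaths 0 i (λ A → sumPaths h (m ∸ suc i) (λ w → f (A ++ D ∷ w))))

  -- Inductive step: both the words starting with U (from height h+2) and the non-empty
  -- prefixes A = U A₁ D A₂ are cut twice, which yields the same double sum.
  firstVisit-step : ∀ k → (∀ m → m ≤ k → FirstVisit m) → FirstVisit (suc k)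
  firstVisit-step k IH h f = begin
    sumPaths (suc h) (suc k) f
      ≈⟨ sumPaths-suc (suc h) k f ⟩
    sumPaths (suc (suc h)) k (λ w → f (U ∷ w)) ⊕ sumPaths h k (λ w → f (D ∷ w))
      ≈⟨ trans (+-comm _ _) (+-cong (sym (+-identityʳ _)) (trans startsU (sym nonEmptyA))) ⟩
    piece 0 ⊕ ⨁< k (λ i → piece (suc i))
      ≈⟨ sym (⨁<-cons k piece) ⟩
    ⨁< (suc k) piece ∎
    where
    piece : ℕ → Carrier
    piece i = sumPaths 0 i (λ A → sumPaths h (suc k ∸ suc i) (λ w → f (A ++ D ∷ w)))

    G : ℕ → ℕ → Carrier
    G i j = sumPaths 0 i (λ A₁ → sumPaths 0 j (λ A₂ →
              sumPaths h ((k ∸ suc i) ∸ suc j) (λ w → f (U ∷ A₁ ++ D ∷ (A₂ ++ D ∷ w)))))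

    startsU : sumPaths (suc (suc h)) k (λ w → f (U ∷ w)) ≈ ⨁< k (λ i → ⨁< (k ∸ suc i) (G i))
    startsU = begin
      sumPaths (suc (suc h)) k (λ w → f (U ∷ w))
        ≈⟨ IH k ℕₚ.≤-refl (suc h) (λ w → f (U ∷ w)) ⟩
      ⨁< k (λ i → sumPaths 0 i (λ A₁ → sumPaths (suc h) (k ∸ suc i) (λ v → f (U ∷ A₁ ++ D ∷ v))))
        ≈⟨ ⨁<-cong k (λ i _ → trans
             (sumPaths-cong 0 i (λ A₁ → IH (k ∸ suc i) (ℕₚ.m∸n≤m k (suc i)) h (λ v → f (U ∷ A₁ ++ D ∷ v))))
             (sumPaths-⨁< 0 i (k ∸ suc i) (λ j A₁ → sumPaths 0 j (λ A₂ →
                sumPaths h ((k ∸ suc i) ∸ suc j) (λ w → f (U ∷ A₁ ++ D ∷ (A₂ ++ D ∷ w))))))) ⟩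
      ⨁< k (λ i → ⨁< (k ∸ suc i) (G i)) ∎

    index : ∀ i j → j < i → (k ∸ suc j) ∸ suc (i ∸ suc j) ≡ k ∸ suc i
    index i j j<i = P.trans (ℕₚ.∸-+-assoc k (suc j) (suc (i ∸ suc j)))
      (P.cong (k ∸_) (P.trans (ℕₚ.+-suc (suc j) (i ∸ suc j)) (P.cong suc (ℕₚ.m+[n∸m]≡n j<i))))

    -- A non-empty Dyck prefix is U A₁ D A₂.
    cut : ∀ i → i < k → piece (suc i) ≈ ⨁< i (λ j → G j (i ∸ suc j))
    cut i i<k = begin
      piece (suc i)
        ≈⟨ trans (sumPaths-suc 0 i _) (+-identityʳ _) ⟩
      sumPaths 1 i (λ A → sumPaths h (k ∸ suc i) (λ w → f ((U ∷ A) ++ D ∷ w)))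
        ≈⟨ IH i (ℕₚ.≤-trans (ℕₚ.n≤1+n i) i<k) 0 (λ A → sumPaths h (k ∸ suc i) (λ w → f ((U ∷ A) ++ D ∷ w))) ⟩
      ⨁< i (λ j → sumPaths 0 j (λ A₁ → sumPaths 0 (i ∸ suc j) (λ A₂ →
        sumPaths h (k ∸ suc i) (λ w → f ((U ∷ A₁ ++ D ∷ A₂) ++ D ∷ w)))))
        ≈⟨ ⨁<-cong i (λ j j<i → sumPaths-cong 0 j (λ A₁ →
             sumPaths-cong 0 (i ∸ suc j) (λ A₂ → reassoc j j<i A₁ A₂))) ⟩
      ⨁< i (λ j → G j (i ∸ suc j)) ∎
      where
      reassoc : ∀ j → j < i → ∀ A₁ A₂ →
        sumPaths h (k ∸ suc i) (λ w → f ((U ∷ A₁ ++ D ∷ A₂) ++ D ∷ w))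
        ≈ sumPaths h ((k ∸ suc j) ∸ suc (i ∸ suc j)) (λ w → f (U ∷ A₁ ++ D ∷ (A₂ ++ D ∷ w)))
      reassoc j j<i A₁ A₂ = trans
        (sumPaths-cong h (k ∸ suc i) (λ w → ≡⇒≈ (P.cong (λ z → f (U ∷ z)) (++-assoc A₁ (D ∷ A₂) (D ∷ w)))))
        (≡⇒≈ (P.cong (λ m → sumPaths h m (λ w → f (U ∷ A₁ ++ D ∷ (A₂ ++ D ∷ w)))) (P.sym (index i j j<i))))

    nonEmptyA : ⨁< k (λ i → piece (suc i)) ≈ ⨁< k (λ i → ⨁< (k ∸ suc i) (G i))
    nonEmptyA = trans (⨁<-cong k cut) (triangle k G)

  firstVisit : ∀ m → FirstVisit m
  firstVisit = <-rec FirstVisit step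
    where
    step : ∀ m → (∀ {m'} → m' < m → FirstVisit m') → FirstVisit m
    step zero    _   h f = refl
    step (suc k) rec     = firstVisit-step k (λ m m≤k → rec (s≤s m≤k))

  odd : ℕ → Bool
  odd zero    = false
  odd (suc n) = not (odd n)

  odd-double : ∀ a → odd (2 ℕ.* a) ≡ false
  odd-double zero    = P.refl
  odd-double (suc a) = P.trans (P.cong odd (ℕₚ.*-suc 2 a)) (P.trans (not-involutive (odd (2 ℕ.* a))) (odd-double a))

  -- Every step changes the parity of the height, so no word of odd length h + k
  -- leads from height h down to 0.
  sumPaths-odd : ∀ k h g → odd (h ℕ.+ k) ≡ true → sumPaths h k g ≈ 0#
  sumPaths-odd zero    zero    g ()
  sumPaths-odd zero    (suc h) g _ = refl
  sumPaths-odd (suc k) h g odd-h+k = begin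
    sumPaths h (suc k) g                                         ≈⟨ sumPaths-suc h k g ⟩
    sumPaths (suc h) k (λ w → g (U ∷ w)) ⊕ sumPathsAfterD h k g
      ≈⟨ +-cong (sumPaths-odd k (suc h) _ (P.trans (P.cong odd (P.sym (ℕₚ.+-suc h k))) odd-h+k)) (afterD h odd-h+k) ⟩
    0# ⊕ 0#                                                      ≈⟨ +-identityʳ 0# ⟩
    0#                                                           ∎
    where
    afterD : ∀ h → odd (h ℕ.+ suc k) ≡ true → sumPathsAfterD h k g ≈ 0#
    afterD zero    _ = refl
    afterD (suc h) e = sumPaths-odd k h _ (P.trans (P.sym (not-involutive (odd (h ℕ.+ k))))
                                          (P.trans (P.cong (λ m → odd (suc m)) (P.sym (ℕₚ.+-suc h k))) e))

  ⨁<-parity : ∀ n F → ⨁< (suc (2 ℕ.* n)) F ≈ ⨁< (suc n) (λ a → F (2 ℕ.* a)) ⊕ ⨁< n (λ a → F (suc (2 ℕ.* a)))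
  ⨁<-parity zero    F = sym (+-identityʳ _)
  ⨁<-parity (suc n) F = begin
    ⨁< (suc (2 ℕ.* suc n)) F
      ≈⟨ ⨁<-length F (P.cong suc (ℕₚ.*-suc 2 n)) ⟩
    (⨁< (suc (2 ℕ.* n)) F ⊕ F (suc (2 ℕ.* n))) ⊕ F (suc (suc (2 ℕ.* n)))
      ≈⟨ +-congʳ (+-congʳ (⨁<-parity n F)) ⟩
    ((evens ⊕ odds) ⊕ F (suc (2 ℕ.* n))) ⊕ F (suc (suc (2 ℕ.* n)))
      ≈⟨ trans (+-assoc _ _ _) (trans (+-congˡ (+-comm _ _)) (⊕-interchange evens odds _ _)) ⟩
    (evens ⊕ F (suc (suc (2 ℕ.* n)))) ⊕ (odds ⊕ F (suc (2 ℕ.* n)))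
      ≈⟨ +-congʳ (+-congˡ (≡⇒≈ (P.cong F (P.sym (ℕₚ.*-suc 2 n))))) ⟩
    (evens ⊕ F (2 ℕ.* suc n)) ⊕ (odds ⊕ F (suc (2 ℕ.* n))) ∎
    where
    evens = ⨁< (suc n) (λ a → F (2 ℕ.* a))
    odds  = ⨁< n (λ a → F (suc (2 ℕ.* a)))

  firstReturn : ∀ n f →
    sumDyck (suc n) f ≈ ⨁< (suc n) (λ a → sumDyck a (λ A → sumDyck (n ∸ a) (λ B → f (U ∷ A ++ D ∷ B))))
  firstReturn n f = begin
    sumPaths 0 (suc K) f                              ≈⟨ trans (sumPaths-suc 0 K f) (+-identityʳ _) ⟩
    sumPaths 1 K (λ w → f (U ∷ w))                    ≈⟨ firstVisit K 0 (λ w → f (U ∷ w)) ⟩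
    ⨁< K F                                           ≈⟨ ⨁<-length F K≡ ⟩
    ⨁< (suc (2 ℕ.* n)) F                             ≈⟨ ⨁<-parity n F ⟩
    ⨁< (suc n) (λ a → F (2 ℕ.* a)) ⊕ ⨁< n (λ a → F (suc (2 ℕ.* a)))
      ≈⟨ +-cong (⨁<-cong (suc n) even) (trans (⨁<-cong n (λ a _ → sumPaths-odd (suc (2 ℕ.* a)) 0 _
                   (P.cong not (odd-double a)))) (⨁<-0 n)) ⟩
    ⨁< (suc n) (λ a → sumDyck a (λ A → sumDyck (n ∸ a) (λ B → f (U ∷ A ++ D ∷ B)))) ⊕ 0# ≈⟨ +-identityʳ _ ⟩
    ⨁< (suc n) (λ a → sumDyck a (λ A → sumDyck (n ∸ a) (λ B → f (U ∷ A ++ D ∷ B)))) ∎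
    where
    K = n ℕ.+ suc (n ℕ.+ 0)
    K≡ : K ≡ suc (2 ℕ.* n)
    K≡ = ℕₚ.+-suc n (n ℕ.+ 0)
    F : ℕ → Carrier
    F i = sumPaths 0 i (λ A → sumPaths 0 (K ∸ suc i) (λ w → f (U ∷ A ++ D ∷ w)))
    even : ∀ a → a < suc n → F (2 ℕ.* a) ≈ sumDyck a (λ A → sumDyck (n ∸ a) (λ B → f (U ∷ A ++ D ∷ B)))
    even a _ = sumPaths-cong 0 (2 ℕ.* a) (λ A → ≡⇒≈ (P.cong (λ m → sumPaths 0 m (λ w → f (U ∷ A ++ D ∷ w)))
                 (P.trans (P.cong (_∸ suc (2 ℕ.* a)) K≡) (P.sym (ℕₚ.*-distribˡ-∸ 2 n a)))))

  sumDyck-cong-on : ∀ a {f g} → (∀ A → isDyck A ≡ true → length A ≡ 2 ℕ.* a → f A ≈ g A) → sumDyck a f ≈ sumDyck a g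
  sumDyck-cong-on a = sumPaths-cong-on (2 ℕ.* a) 0

  sumDyck-cong : ∀ a {f g} → (∀ A → f A ≈ g A) → sumDyck a f ≈ sumDyck a g
  sumDyck-cong a = sumOver-cong (dyckPaths a)

  sumDyck-product : ∀ a b x y → sumDyck a (λ A → sumDyck b (λ B → x A ⊗ y B)) ≈ sumDyck a x ⊗ sumDyck b y
  sumDyck-product a b x y = trans (sumOver-cong (dyckPaths a) (λ A → sumOver-*ˡ (x A) y (dyckPaths b)))
                                  (sumOver-*ʳ (sumDyck b y) x (dyckPaths a))

  sumDyck-*ˡ : ∀ a z f → sumDyck a (λ A → z ⊗ f A) ≈ z ⊗ sumDyck a f
  sumDyck-*ˡ a z f = sumOver-*ˡ z f (dyckPaths a)

  sumDyck-0 : ∀ f → sumDyck 0 f ≈ f []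
  sumDyck-0 f = +-identityʳ (f [])

-- Convolution of sequences, and the algebra of the continued fraction
--   L s = 1 / (1 - s z M s),   M s = 1 / (1 - q z L s (q z)),
-- written coefficientwise.
module StieltjesFraction {c ℓ : Level} (R : CommutativeSemiring c ℓ) where
  open PathSums R using (⨁<; ⨁<-cong; ⨁<-length; ⨁<-cons; ⨁<-*ˡ; triangle; ≡⇒≈; pow-+)
  open import Data.Nat as ℕ using (zero; suc; _≤_; _<_; s≤s; s≤s⁻¹)
  import Data.Nat.Properties as ℕₚ
  open import Data.Nat.Induction using (<-rec)
  import Relation.Binary.PropositionalEquality as P

  open CommutativeSemiring R hiding (zero) renaming (_+_ to _⊕_; _*_ to _⊗_)
  open import Relation.Binary.Reasoning.Setoid setoid
  open import Algebra.Properties.CommutativeSemigroup *-commutativeSemigroup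
    using () renaming (interchange to ⊗-interchange; x∙yz≈y∙xz to ⊗-lcomm)
  open import Algebra.Properties.CommutativeSemigroup +-commutativeSemigroup
    using () renaming (x∙yz≈y∙xz to ⊕-lcomm)

  Seq : Set c
  Seq = ℕ → Carrier

  conv : Seq → Seq → Seq
  conv f g n = ⨁< (suc n) (λ k → f k ⊗ g (n ∸ k))

  convTail : Seq → Seq → Seq
  convTail f g n = ⨁< n (λ k → f (suc k) ⊗ g (n ∸ suc k))

  conv-0 : ∀ {f g} → f 0 ≈ 1# → g 0 ≈ 1# → conv f g 0 ≈ 1#
  conv-0 f0 g0 = trans (+-identityˡ _) (trans (*-cong f0 g0) (*-identityˡ 1#))

  conv-head : ∀ n f g → conv f g n ≈ f 0 ⊗ g n ⊕ convTail f g n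
  conv-head n f g = ⨁<-cons n (λ k → f k ⊗ g (n ∸ k))

  conv-unit : ∀ n f X → f 0 ≈ 1# → conv f X n ≈ X n ⊕ convTail f X n
  conv-unit n f X f0 = trans (conv-head n f X) (+-congʳ (trans (*-congʳ f0) (*-identityˡ _)))

  conv-cong : ∀ n {f f' g g' : Seq} → (∀ k → k ≤ n → f k ≈ f' k) → (∀ k → k ≤ n → g k ≈ g' k) →
    conv f g n ≈ conv f' g' n
  conv-cong n f≈ g≈ = ⨁<-cong (suc n) (λ k k< → *-cong (f≈ k (s≤s⁻¹ k<)) (g≈ (n ∸ k) (ℕₚ.m∸n≤m n k)))

  convTail-cong : ∀ n {f f' g g' : Seq} → (∀ k → k < n → f (suc k) ≈ f' (suc k)) → (∀ k → k ≤ n → g k ≈ g' k) →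
    convTail f g n ≈ convTail f' g' n
  convTail-cong n f≈ g≈ = ⨁<-cong n (λ k k< → *-cong (f≈ k k<) (g≈ (n ∸ suc k) (ℕₚ.m∸n≤m n (suc k))))

  conv-*ˡ : ∀ n a f g → conv (λ k → a ⊗ f k) g n ≈ a ⊗ conv f g n
  conv-*ˡ n a f g = trans (⨁<-cong (suc n) (λ k _ → *-assoc a (f k) _)) (⨁<-*ˡ (suc n) a _)

  conv-*ʳ : ∀ n a f g → conv f (λ k → a ⊗ g k) n ≈ a ⊗ conv f g n
  conv-*ʳ n a f g = trans (⨁<-cong (suc n) (λ k _ → ⊗-lcomm (f k) a _)) (⨁<-*ˡ (suc n) a _)

  convTail-*ˡ : ∀ n a f g → convTail (λ k → a ⊗ f k) g n ≈ a ⊗ convTail f g n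
  convTail-*ˡ n a f g = trans (⨁<-cong n (λ k _ → *-assoc a (f (suc k)) _)) (⨁<-*ˡ n a _)

  -- Associativity: both sides sum f j g m h (n-j-m) over j + m ≤ n.
  conv-assoc : ∀ n f g h → conv (conv f g) h n ≈ conv f (conv g h) n
  conv-assoc n f g h = begin
    ⨁< (suc n) (λ k → ⨁< (suc k) (λ j → f j ⊗ g (k ∸ j)) ⊗ h (n ∸ k))
      ≈⟨ ⨁<-cong (suc n) (λ k k< → trans (*-comm _ _) (trans (sym (⨁<-*ˡ (suc k) (h (n ∸ k)) _))
           (⨁<-cong (suc k) (λ j j< → trans (*-comm _ _)
             (*-congˡ (≡⇒≈ (P.cong h (P.cong (n ∸_) (P.sym (ℕₚ.m+[n∸m]≡n (s≤s⁻¹ j<))))))))))) ⟩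
    ⨁< (suc n) (λ k → X (suc k))
      ≈⟨ sym (trans (⨁<-cons (suc n) X) (+-identityˡ _)) ⟩
    ⨁< (suc (suc n)) X
      ≈⟨ triangle (suc (suc n)) G ⟩
    ⨁< (suc n) (λ j → ⨁< (suc n ∸ j) (G j)) ⊕ ⨁< (suc n ∸ suc n) (G (suc n))
      ≈⟨ trans (+-congˡ (⨁<-length (G (suc n)) (ℕₚ.n∸n≡0 (suc n)))) (+-identityʳ _) ⟩
    ⨁< (suc n) (λ j → ⨁< (suc n ∸ j) (G j))
      ≈⟨ ⨁<-cong (suc n) (λ j j< → trans (⨁<-length (G j) (ℕₚ.+-∸-assoc 1 (s≤s⁻¹ j<)))
           (trans (⨁<-cong (suc (n ∸ j)) (λ m _ → trans (*-assoc (f j) (g m) _)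
              (*-congˡ (*-congˡ (≡⇒≈ (P.cong h (P.sym (ℕₚ.∸-+-assoc n j m))))))))
             (⨁<-*ˡ (suc (n ∸ j)) (f j) (λ m → g m ⊗ h ((n ∸ j) ∸ m))))) ⟩
    ⨁< (suc n) (λ j → f j ⊗ conv g h (n ∸ j)) ∎
    where
    G : ℕ → ℕ → Carrier
    G j m = (f j ⊗ g m) ⊗ h (n ∸ (j ℕ.+ m))
    X : ℕ → Carrier
    X i = ⨁< i (λ j → G j (i ∸ suc j))

  conv-scale : ∀ q n f g → pow R q n ⊗ conv f g n ≈ conv (λ k → pow R q k ⊗ f k) (λ k → pow R q k ⊗ g k) n
  conv-scale q n f g = trans (sym (⨁<-*ˡ (suc n) (pow R q n) (λ k → f k ⊗ g (n ∸ k))))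
    (⨁<-cong (suc n) (λ k k< → begin
      pow R q n ⊗ (f k ⊗ g (n ∸ k))
        ≈⟨ *-congʳ (≡⇒≈ (P.cong (pow R q) (P.sym (ℕₚ.m+[n∸m]≡n (s≤s⁻¹ k<))))) ⟩
      pow R q (k ℕ.+ (n ∸ k)) ⊗ (f k ⊗ g (n ∸ k))       ≈⟨ *-congʳ (pow-+ q k (n ∸ k)) ⟩
      (pow R q k ⊗ pow R q (n ∸ k)) ⊗ (f k ⊗ g (n ∸ k)) ≈⟨ ⊗-interchange _ _ _ _ ⟩
      (pow R q k ⊗ f k) ⊗ (pow R q (n ∸ k) ⊗ g (n ∸ k)) ∎))

  recursion-unique : ∀ {i} {I : Set i} (step : (I → Seq) → I → ℕ → Carrier) →
    (∀ {X Y} n → (∀ i j → j ≤ n → X i j ≈ Y i j) → ∀ i → step X i n ≈ step Y i n) →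
    ∀ {X Y : I → Seq} → (∀ i → X i 0 ≈ Y i 0) →
    (∀ i n → X i (suc n) ≈ step X i n) → (∀ i n → Y i (suc n) ≈ step Y i n) →
    ∀ n i → X i n ≈ Y i n
  recursion-unique step step-cong {X} {Y} X0≈Y0 X-rec Y-rec = <-rec (λ n → ∀ i → X i n ≈ Y i n) agree
    where
    agree : ∀ n → (∀ {m} → m < n → ∀ i → X i m ≈ Y i m) → ∀ i → X i n ≈ Y i n
    agree zero    _  i = X0≈Y0 i
    agree (suc n) IH i = begin
      X i (suc n)  ≈⟨ X-rec i n ⟩
      step X i n   ≈⟨ step-cong n (λ i' j j≤n → IH (s≤s j≤n) i') i ⟩
      step Y i n   ≈⟨ sym (Y-rec i n) ⟩
      Y i (suc n)  ∎

  module _ (q : Carrier) where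

    -- The recursions of the peak and of the tunnel generating functions:
    --   F s (n+1) = s F s n + Σ_{a<n} F (q s) (a+1) F s (n-1-a)      (U A D B, A ≠ [] raised by one level)
    --   G s (n+1) = Σ_{a<n} q^(a+1) G s a G s (n-a) + s G s n      (the junction tunnel has semilength a+1)
    peakStep : (Carrier → Seq) → Carrier → ℕ → Carrier
    peakStep F s n = s ⊗ F s n ⊕ ⨁< n (λ a → F (q ⊗ s) (suc a) ⊗ F s (n ∸ suc a))

    tunnelStep : (Carrier → Seq) → Carrier → ℕ → Carrier
    tunnelStep G s n = ⨁< n (λ a → pow R q (suc a) ⊗ (G s a ⊗ G s (n ∸ a))) ⊕ s ⊗ G s n

    peakStep-cong : ∀ {X Y} n → (∀ s j → j ≤ n → X s j ≈ Y s j) → ∀ s → peakStep X s n ≈ peakStep Y s n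
    peakStep-cong n X≈Y s = +-cong (*-congˡ (X≈Y s n ℕₚ.≤-refl))
      (⨁<-cong n (λ a a<n → *-cong (X≈Y (q ⊗ s) (suc a) a<n) (X≈Y s (n ∸ suc a) (ℕₚ.m∸n≤m n (suc a)))))

    tunnelStep-cong : ∀ {X Y} n → (∀ s j → j ≤ n → X s j ≈ Y s j) → ∀ s → tunnelStep X s n ≈ tunnelStep Y s n
    tunnelStep-cong n X≈Y s = +-cong
      (⨁<-cong n (λ a a<n → *-congˡ (*-cong (X≈Y s a (ℕₚ.<⇒≤ a<n)) (X≈Y s (n ∸ a) (ℕₚ.m∸n≤m n a)))))
      (*-congˡ (X≈Y s n ℕₚ.≤-refl))

    module ContinuedFraction (L M : Carrier → Seq)
      (L-0 : ∀ s → L s 0 ≈ 1#) (M-0 : ∀ s → M s 0 ≈ 1#)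
      (L-suc : ∀ s n → L s (suc n) ≈ s ⊗ conv (M s) (L s) n)
      (M-suc : ∀ s n → M s (suc n) ≈ q ⊗ conv (λ k → pow R q k ⊗ L s k) (M s) n) where

      -- L (q s) (n+1) = q s · A n and s · M s (n+1) = s q · A' n.  Both A and A' solve
      -- A (n+1) = E A n, the latter as long as L (q s) k = s · M s k for 1 ≤ k ≤ n,
      -- so A = A' and the identity follow together by strong induction.
      module Shift (s : Carrier) where
        s' : Carrier
        s' = q ⊗ s

        Lq Lq' Mq : Seq
        Lq  k = pow R q k ⊗ L s k
        Lq' k = pow R q k ⊗ L s' k
        Mq  k = pow R q k ⊗ M s k

        A A' : Seq
        A  = conv (M s') (L s')
        A' = conv Lq (M s)

        E : Seq → Seq
        E X n = s' ⊗ X n ⊕ q ⊗ conv Lq' X n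

        E-cong : ∀ n {X Y} → (∀ j → j ≤ n → X j ≈ Y j) → E X n ≈ E Y n
        E-cong n X≈Y = +-cong (*-congˡ (X≈Y n ℕₚ.≤-refl)) (*-congˡ (conv-cong n (λ _ _ → refl) X≈Y))

        A-suc : ∀ n → A (suc n) ≈ E A n
        A-suc n = begin
          A (suc n)                                             ≈⟨ conv-head (suc n) (M s') (L s') ⟩
          M s' 0 ⊗ L s' (suc n) ⊕ conv (λ k → M s' (suc k)) (L s') n
            ≈⟨ +-cong (trans (*-cong (M-0 s') (L-suc s' n)) (*-identityˡ _))
                      (conv-cong n {g = L s'} {g' = L s'} (λ k _ → M-suc s' k) (λ _ _ → refl)) ⟩
          s' ⊗ A n ⊕ conv (λ k → q ⊗ conv Lq' (M s') k) (L s') n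
            ≈⟨ +-congˡ (trans (conv-*ˡ n q (conv Lq' (M s')) (L s')) (*-congˡ (conv-assoc n Lq' (M s') (L s')))) ⟩
          E A n                                                 ∎

        Lq-suc : ∀ n → Lq (suc n) ≈ s' ⊗ conv Mq Lq n
        Lq-suc n = begin
          (q ⊗ pow R q n) ⊗ L s (suc n)                 ≈⟨ *-congˡ (L-suc s n) ⟩
          (q ⊗ pow R q n) ⊗ (s ⊗ conv (M s) (L s) n)    ≈⟨ ⊗-interchange _ _ _ _ ⟩
          s' ⊗ (pow R q n ⊗ conv (M s) (L s) n)         ≈⟨ *-congˡ (conv-scale q n (M s) (L s)) ⟩
          s' ⊗ conv Mq Lq n                             ∎

        A'-suc : ∀ n → A' (suc n) ≈ q ⊗ A' n ⊕ s' ⊗ conv Mq A' n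
        A'-suc n = begin
          A' (suc n)                                     ≈⟨ conv-head (suc n) Lq (M s) ⟩
          Lq 0 ⊗ M s (suc n) ⊕ conv (λ k → Lq (suc k)) (M s) n
            ≈⟨ +-cong (trans (*-cong (trans (*-identityˡ _) (L-0 s)) (M-suc s n)) (*-identityˡ _))
                      (conv-cong n {g = M s} {g' = M s} (λ k _ → Lq-suc k) (λ _ _ → refl)) ⟩
          q ⊗ A' n ⊕ conv (λ k → s' ⊗ conv Mq Lq k) (M s) n
            ≈⟨ +-congˡ (trans (conv-*ˡ n s' (conv Mq Lq) (M s)) (*-congˡ (conv-assoc n Mq Lq (M s)))) ⟩
          q ⊗ A' n ⊕ s' ⊗ conv Mq A' n                  ∎

        shift-from : ∀ j → A j ≈ A' j → L s' (suc j) ≈ s ⊗ M s (suc j)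
        shift-from j A≈A' = begin
          L s' (suc j)     ≈⟨ L-suc s' j ⟩
          s' ⊗ A j         ≈⟨ *-congˡ A≈A' ⟩
          (q ⊗ s) ⊗ A' j   ≈⟨ trans (*-congʳ (*-comm q s)) (*-assoc s q _) ⟩
          s ⊗ (q ⊗ A' j)   ≈⟨ *-congˡ (sym (M-suc s j)) ⟩
          s ⊗ M s (suc j)  ∎

        A'-suc-below : ∀ n → (∀ j → j < n → A j ≈ A' j) → A' (suc n) ≈ E A' n
        A'-suc-below n below = begin
          A' (suc n)                                          ≈⟨ A'-suc n ⟩
          q ⊗ A' n ⊕ s' ⊗ conv Mq A' n
            ≈⟨ +-congˡ (*-congˡ (conv-unit n Mq A' (trans (*-identityˡ _) (M-0 s)))) ⟩
          q ⊗ A' n ⊕ s' ⊗ (A' n ⊕ convTail Mq A' n)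
            ≈⟨ +-congˡ (trans (distribˡ s' _ _) (+-congˡ tails)) ⟩
          q ⊗ A' n ⊕ (s' ⊗ A' n ⊕ q ⊗ convTail Lq' A' n)
            ≈⟨ ⊕-lcomm _ _ _ ⟩
          s' ⊗ A' n ⊕ (q ⊗ A' n ⊕ q ⊗ convTail Lq' A' n)
            ≈⟨ +-congˡ (sym (distribˡ q _ _)) ⟩
          s' ⊗ A' n ⊕ q ⊗ (A' n ⊕ convTail Lq' A' n)
            ≈⟨ +-congˡ (*-congˡ (sym (conv-unit n Lq' A' (trans (*-identityˡ _) (L-0 s'))))) ⟩
          E A' n ∎
          where
          tails : s' ⊗ convTail Mq A' n ≈ q ⊗ convTail Lq' A' n
          tails = begin
            s' ⊗ convTail Mq A' n                  ≈⟨ sym (convTail-*ˡ n s' Mq A') ⟩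
            convTail (λ k → s' ⊗ Mq k) A' n
              ≈⟨ convTail-cong n {f = λ k → s' ⊗ Mq k} {f' = λ k → q ⊗ Lq' k} {g = A'} {g' = A'} (λ k k<n → begin
                   (q ⊗ s) ⊗ (pow R q (suc k) ⊗ M s (suc k)) ≈⟨ ⊗-interchange _ _ _ _ ⟩
                   (q ⊗ pow R q (suc k)) ⊗ (s ⊗ M s (suc k)) ≈⟨ *-assoc _ _ _ ⟩
                   q ⊗ (pow R q (suc k) ⊗ (s ⊗ M s (suc k))) ≈⟨ *-congˡ (*-congˡ (sym (shift-from k (below k k<n)))) ⟩
                   q ⊗ Lq' (suc k)                           ∎) (λ _ _ → refl) ⟩
            convTail (λ k → q ⊗ Lq' k) A' n        ≈⟨ convTail-*ˡ n q Lq' A' ⟩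
            q ⊗ convTail Lq' A' n                  ∎

        A≈A' : ∀ n → A n ≈ A' n
        A≈A' = <-rec (λ n → A n ≈ A' n) agree
          where
          agree : ∀ n → (∀ {m} → m < n → A m ≈ A' m) → A n ≈ A' n
          agree zero    _  = trans (conv-0 {M s'} {L s'} (M-0 s') (L-0 s'))
                                   (sym (conv-0 {Lq} {M s} (trans (*-identityˡ _) (L-0 s)) (M-0 s)))
          agree (suc n) IH = begin
            A (suc n)   ≈⟨ A-suc n ⟩
            E A n       ≈⟨ E-cong n (λ j j≤n → IH (s≤s j≤n)) ⟩
            E A' n      ≈⟨ sym (A'-suc-below n (λ j j<n → IH (ℕₚ.<-trans j<n (ℕₚ.n<1+n n)))) ⟩
            A' (suc n)  ∎

      shift : ∀ s n → L (q ⊗ s) (suc n) ≈ s ⊗ M s (suc n)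
      shift s n = Shift.shift-from s n (Shift.A≈A' s n)

      L-suc-split : ∀ s n → L s (suc n) ≈ s ⊗ L s n ⊕ s ⊗ convTail (M s) (L s) n
      L-suc-split s n = begin
        L s (suc n)                                           ≈⟨ L-suc s n ⟩
        s ⊗ conv (M s) (L s) n                                ≈⟨ *-congˡ (conv-head n (M s) (L s)) ⟩
        s ⊗ (M s 0 ⊗ L s n ⊕ convTail (M s) (L s) n)         ≈⟨ distribˡ s _ _ ⟩
        s ⊗ (M s 0 ⊗ L s n) ⊕ s ⊗ convTail (M s) (L s) n
          ≈⟨ +-congʳ (*-congˡ (trans (*-congʳ (M-0 s)) (*-identityˡ _))) ⟩
        s ⊗ L s n ⊕ s ⊗ convTail (M s) (L s) n               ∎

      -- L solves the peak recursion: s M s (a+1) is L (q s) (a+1) by `shift`.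
      L-peak : ∀ s n → L s (suc n) ≈ peakStep L s n
      L-peak s n = trans (L-suc-split s n) (+-congˡ (begin
        s ⊗ convTail (M s) (L s) n                                   ≈⟨ sym (⨁<-*ˡ n s _) ⟩
        ⨁< n (λ a → s ⊗ (M s (suc a) ⊗ L s (n ∸ suc a)))
          ≈⟨ ⨁<-cong n (λ a _ → trans (sym (*-assoc s _ _)) (*-congʳ (sym (shift s a)))) ⟩
        ⨁< n (λ a → L (q ⊗ s) (suc a) ⊗ L s (n ∸ suc a))            ∎))

      -- L solves the tunnel recursion: expanding M s (k+1) once more and
      -- re-associating turns the tail of s (M s ∗ L s) into Σ q^(a+1) L s a L s (n-a).
      tail-tunnel : ∀ s n → s ⊗ convTail (M s) (L s) n ≈ ⨁< n (λ a → pow R q (suc a) ⊗ (L s a ⊗ L s (n ∸ a)))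
      tail-tunnel s zero    = zeroʳ s
      tail-tunnel s (suc m) = begin
        s ⊗ conv (λ k → M s (suc k)) (L s) m
          ≈⟨ *-congˡ (conv-cong m {g = L s} {g' = L s} (λ k _ → M-suc s k) (λ _ _ → refl)) ⟩
        s ⊗ conv (λ k → q ⊗ conv Lq (M s) k) (L s) m
          ≈⟨ *-congˡ (trans (conv-*ˡ m q (conv Lq (M s)) (L s)) (*-congˡ (conv-assoc m Lq (M s) (L s)))) ⟩
        s ⊗ (q ⊗ conv Lq (conv (M s) (L s)) m)
          ≈⟨ trans (⊗-lcomm s q _) (*-congˡ (sym (conv-*ʳ m s Lq (conv (M s) (L s))))) ⟩
        q ⊗ conv Lq (λ j → s ⊗ conv (M s) (L s) j) m
          ≈⟨ *-congˡ (conv-cong m {f = Lq} {f' = Lq} (λ _ _ → refl) (λ j _ → sym (L-suc s j))) ⟩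
        q ⊗ conv Lq (λ j → L s (suc j)) m
          ≈⟨ sym (⨁<-*ˡ (suc m) q (λ k → Lq k ⊗ L s (suc (m ∸ k)))) ⟩
        ⨁< (suc m) (λ k → q ⊗ ((pow R q k ⊗ L s k) ⊗ L s (suc (m ∸ k))))
          ≈⟨ ⨁<-cong (suc m) (λ k k< → trans (sym (*-assoc q _ _)) (trans (*-congʳ (sym (*-assoc q _ _)))
               (trans (*-assoc _ _ _) (*-congˡ (*-congˡ (≡⇒≈ (P.cong (L s) (P.sym (ℕₚ.+-∸-assoc 1 (s≤s⁻¹ k<)))))))))) ⟩
        ⨁< (suc m) (λ a → pow R q (suc a) ⊗ (L s a ⊗ L s (suc m ∸ a))) ∎
        where
        Lq : Seq
        Lq k = pow R q k ⊗ L s k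

      L-tunnel : ∀ s n → L s (suc n) ≈ tunnelStep L s n
      L-tunnel s n = trans (L-suc-split s n) (trans (+-comm _ _) (+-congʳ (tail-tunnel s n)))

module Equidistribution {c ℓ : Level} (R : CommutativeSemiring c ℓ) (q : CommutativeSemiring.Carrier R) where
  open Paths using (isEmpty; module FirstReturn;
                    semilength≡countU; des≤semilength; half-suc-suc-double)
  open PathSums R
  open StieltjesFraction R
  open import Data.Nat as ℕ using (zero; suc; _≤_; _<_; s≤s)
  import Data.Nat.Properties as ℕₚ
  open import Data.Bool using (true)
  open import Data.List using (List; []; _∷_; _++_; length)
  import Relation.Binary.PropositionalEquality as P
  open P using (_≡_)

  open CommutativeSemiring R hiding (zero) renaming (_+_ to _⊕_; _*_ to _⊗_)
  open import Relation.Binary.Reasoning.Setoid setoid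
  open import Algebra.Properties.CommutativeSemigroup *-commutativeSemigroup
    using () renaming (interchange to ⊗-interchange; x∙yz≈y∙xz to ⊗-lcomm)

  upWeight : (ℕ → Carrier) → ℕ → List Step → Carrier
  upWeight wt h []      = 1#
  upWeight wt h (U ∷ w) = wt (suc h) ⊗ upWeight wt (suc h) w
  upWeight wt h (D ∷ w) = upWeight wt (ℕ.pred h) w

  upWeight-++ : ∀ wt r A → dyckFrom r A ≡ true → ∀ h y →
    upWeight wt (r ℕ.+ h) (A ++ y) ≈ upWeight wt (r ℕ.+ h) A ⊗ upWeight wt h y
  upWeight-++ wt zero    []      d  h y = sym (*-identityˡ _)
  upWeight-++ wt zero    (U ∷ A) d  h y = trans (*-congˡ (upWeight-++ wt 1 A d h y)) (sym (*-assoc _ _ _))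
  upWeight-++ wt (suc r) (U ∷ A) d  h y = trans (*-congˡ (upWeight-++ wt (suc (suc r)) A d h y)) (sym (*-assoc _ _ _))
  upWeight-++ wt (suc r) (D ∷ A) d  h y = upWeight-++ wt r A d h y

  upWeight-UADB : ∀ wt h A B → isDyck A ≡ true →
    upWeight wt h (U ∷ A ++ D ∷ B) ≈ wt (suc h) ⊗ (upWeight wt (suc h) A ⊗ upWeight wt h B)
  upWeight-UADB wt h A B d = *-congˡ (upWeight-++ wt 0 A d (suc h) (D ∷ B))

  upWeight-raise₂ : ∀ wt → (∀ h → wt (suc (suc h)) ≈ q ⊗ wt h) →
    ∀ r w → dyckFrom r w ≡ true → upWeight wt (suc (suc r)) w ≈ pow R q (countU w) ⊗ upWeight wt r w
  upWeight-raise₂ wt periodic r       []      d = sym (*-identityˡ 1#)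
  upWeight-raise₂ wt periodic zero    (U ∷ w) d =
    trans (*-cong (periodic 1) (upWeight-raise₂ wt periodic 1 w d)) (⊗-interchange _ _ _ _)
  upWeight-raise₂ wt periodic (suc r) (U ∷ w) d =
    trans (*-cong (periodic (suc (suc r))) (upWeight-raise₂ wt periodic (suc (suc r)) w d)) (⊗-interchange _ _ _ _)
  upWeight-raise₂ wt periodic (suc r) (D ∷ w) d = upWeight-raise₂ wt periodic r w d

  stieltjes : Carrier → ℕ → Carrier
  stieltjes s zero          = 1#
  stieltjes s (suc zero)    = s
  stieltjes s (suc (suc h)) = q ⊗ stieltjes s h

  L M : Carrier → ℕ → Carrier
  L s n = sumDyck n (upWeight (stieltjes s) 0)
  M s n = sumDyck n (upWeight (stieltjes s) 1)

  L-0 : ∀ s → L s 0 ≈ 1#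
  L-0 s = sumDyck-0 (upWeight (stieltjes s) 0)

  M-0 : ∀ s → M s 0 ≈ 1#
  M-0 s = sumDyck-0 (upWeight (stieltjes s) 1)

  L-suc : ∀ s n → L s (suc n) ≈ s ⊗ conv (M s) (L s) n
  L-suc s n = begin
    L s (suc n)
      ≈⟨ firstReturn n (upWeight wt 0) ⟩
    ⨁< (suc n) (λ a → sumDyck a (λ A → sumDyck (n ∸ a) (λ B → upWeight wt 0 (U ∷ A ++ D ∷ B))))
      ≈⟨ ⨁<-cong (suc n) (λ a _ → begin
          sumDyck a (λ A → sumDyck (n ∸ a) (λ B → upWeight wt 0 (U ∷ A ++ D ∷ B)))
            ≈⟨ sumDyck-cong-on a (λ A dA _ → sumDyck-cong (n ∸ a) (λ B →
                 trans (upWeight-UADB wt 0 A B dA) (sym (*-assoc s _ _)))) ⟩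
          sumDyck a (λ A → sumDyck (n ∸ a) (λ B → (s ⊗ upWeight wt 1 A) ⊗ upWeight wt 0 B))
            ≈⟨ sumDyck-product a (n ∸ a) (λ A → s ⊗ upWeight wt 1 A) (upWeight wt 0) ⟩
          sumDyck a (λ A → s ⊗ upWeight wt 1 A) ⊗ L s (n ∸ a)
            ≈⟨ trans (*-congʳ (sumDyck-*ˡ a s (upWeight wt 1))) (*-assoc s _ _) ⟩
          s ⊗ (M s a ⊗ L s (n ∸ a)) ∎) ⟩
    ⨁< (suc n) (λ a → s ⊗ (M s a ⊗ L s (n ∸ a)))
      ≈⟨ ⨁<-*ˡ (suc n) s _ ⟩
    s ⊗ conv (M s) (L s) n ∎
    where wt = stieltjes s

  -- In M, the first return path U A D starts at level 1, so A lives two levels up.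
  M-suc : ∀ s n → M s (suc n) ≈ q ⊗ conv (λ k → pow R q k ⊗ L s k) (M s) n
  M-suc s n = begin
    M s (suc n)
      ≈⟨ firstReturn n (upWeight wt 1) ⟩
    ⨁< (suc n) (λ a → sumDyck a (λ A → sumDyck (n ∸ a) (λ B → upWeight wt 1 (U ∷ A ++ D ∷ B))))
      ≈⟨ ⨁<-cong (suc n) (λ a _ → begin
          sumDyck a (λ A → sumDyck (n ∸ a) (λ B → upWeight wt 1 (U ∷ A ++ D ∷ B)))
            ≈⟨ sumDyck-cong-on a (λ A dA lA → sumDyck-cong (n ∸ a) (λ B → begin
                 upWeight wt 1 (U ∷ A ++ D ∷ B)
                   ≈⟨ upWeight-UADB wt 1 A B dA ⟩
                 (q ⊗ 1#) ⊗ (upWeight wt 2 A ⊗ upWeight wt 1 B)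
                   ≈⟨ *-cong (*-identityʳ q) (*-congʳ (trans (upWeight-raise₂ wt (λ _ → refl) 0 A dA)
                        (*-congʳ (≡⇒≈ (P.cong (pow R q) (semilength≡countU A a dA lA)))))) ⟩
                 q ⊗ ((pow R q a ⊗ upWeight wt 0 A) ⊗ upWeight wt 1 B)
                   ≈⟨ sym (*-assoc q _ _) ⟩
                 (q ⊗ (pow R q a ⊗ upWeight wt 0 A)) ⊗ upWeight wt 1 B ∎)) ⟩
          sumDyck a (λ A → sumDyck (n ∸ a) (λ B → (q ⊗ (pow R q a ⊗ upWeight wt 0 A)) ⊗ upWeight wt 1 B))
            ≈⟨ sumDyck-product a (n ∸ a) (λ A → q ⊗ (pow R q a ⊗ upWeight wt 0 A)) (upWeight wt 1) ⟩
          sumDyck a (λ A → q ⊗ (pow R q a ⊗ upWeight wt 0 A)) ⊗ M s (n ∸ a)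
            ≈⟨ trans (*-congʳ (trans (sumDyck-*ˡ a q _) (*-congˡ (sumDyck-*ˡ a (pow R q a) (upWeight wt 0)))))
                     (*-assoc q _ _) ⟩
          q ⊗ ((pow R q a ⊗ L s a) ⊗ M s (n ∸ a)) ∎) ⟩
    ⨁< (suc n) (λ a → q ⊗ ((pow R q a ⊗ L s a) ⊗ M s (n ∸ a)))
      ≈⟨ ⨁<-*ˡ (suc n) q _ ⟩
    q ⊗ conv (λ k → pow R q k ⊗ L s k) (M s) n ∎
    where wt = stieltjes s

  open ContinuedFraction q L M L-0 M-0 L-suc M-suc using (L-peak; L-tunnel)

  peakWeight : Carrier → List Step → Carrier
  peakWeight s P = pow R q (speaks P) ⊗ pow R s (npeaks P)

  F : Carrier → ℕ → Carrier
  F s n = sumDyck n (peakWeight s)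

  -- U D B: one more peak, at height 1.
  peakWeight-UDB : ∀ s B → isDyck B ≡ true → peakWeight s (U ∷ [] ++ D ∷ B) ≈ s ⊗ peakWeight s B
  peakWeight-UDB s B dB = trans (*-cong (≡⇒≈ (P.cong (pow R q) (FirstReturn.speaks-W [] B P.refl dB)))
                                        (≡⇒≈ (P.cong (pow R s) (FirstReturn.npeaks-W [] B P.refl dB))))
                                (⊗-lcomm _ s _)

  -- U A D B with A ≠ []: each peak of A is one level higher, i.e. s becomes q s on A.
  peakWeight-UADB : ∀ s A B → isDyck A ≡ true → isDyck B ≡ true → isEmpty A ≡ 0 →
    peakWeight s (U ∷ A ++ D ∷ B) ≈ peakWeight (q ⊗ s) A ⊗ peakWeight s B
  peakWeight-UADB s A B dA dB A≢[] = begin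
    pow R q (speaks (U ∷ A ++ D ∷ B)) ⊗ pow R s (npeaks (U ∷ A ++ D ∷ B))
      ≈⟨ *-cong (≡⇒≈ (P.cong (pow R q) (FirstReturn.speaks-W A B dA dB)))
                (≡⇒≈ (P.cong (pow R s) (P.trans (FirstReturn.npeaks-W A B dA dB)
                                                (P.cong (λ z → z ℕ.+ npeaks A ℕ.+ npeaks B) A≢[])))) ⟩
    pow R q (speaks A ℕ.+ npeaks A ℕ.+ speaks B) ⊗ pow R s (npeaks A ℕ.+ npeaks B)
      ≈⟨ *-cong (trans (pow-+ q (speaks A ℕ.+ npeaks A) (speaks B)) (*-congʳ (pow-+ q (speaks A) (npeaks A))))
                (pow-+ s (npeaks A) (npeaks B)) ⟩
    ((pow R q (speaks A) ⊗ pow R q (npeaks A)) ⊗ pow R q (speaks B)) ⊗ (pow R s (npeaks A) ⊗ pow R s (npeaks B))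
      ≈⟨ ⊗-interchange _ _ _ _ ⟩
    ((pow R q (speaks A) ⊗ pow R q (npeaks A)) ⊗ pow R s (npeaks A)) ⊗ (pow R q (speaks B) ⊗ pow R s (npeaks B))
      ≈⟨ *-congʳ (trans (*-assoc _ _ _) (*-congˡ (sym (pow-* q s (npeaks A))))) ⟩
    peakWeight (q ⊗ s) A ⊗ peakWeight s B ∎

  F-suc : ∀ s n → F s (suc n) ≈ peakStep q F s n
  F-suc s n = begin
    F s (suc n)                              ≈⟨ firstReturn n (peakWeight s) ⟩
    ⨁< (suc n) T                             ≈⟨ ⨁<-cons n T ⟩
    T 0 ⊕ ⨁< n (λ a → T (suc a))
      ≈⟨ +-cong (trans (sumDyck-0 (λ A → sumDyck n (λ B → peakWeight s (U ∷ A ++ D ∷ B))))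
                  (trans (sumDyck-cong-on n (λ B dB _ → peakWeight-UDB s B dB)) (sumDyck-*ˡ n s (peakWeight s))))
                (⨁<-cong n (λ a _ → trans
                  (sumDyck-cong-on (suc a) (λ A dA lA → sumDyck-cong-on (n ∸ suc a) (λ B dB _ →
                      peakWeight-UADB s A B dA dB (nonEmpty A a lA))))
                  (sumDyck-product (suc a) (n ∸ suc a) (peakWeight (q ⊗ s)) (peakWeight s)))) ⟩
    peakStep q F s n                         ∎
    where
    T : ℕ → Carrier
    T a = sumDyck a (λ A → sumDyck (n ∸ a) (λ B → peakWeight s (U ∷ A ++ D ∷ B)))
    nonEmpty : ∀ A a → length A ≡ 2 ℕ.* suc a → isEmpty A ≡ 0
    nonEmpty (_ ∷ _) a _ = P.refl

  tunnelWeight : Carrier → ℕ → List Step → Carrier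
  tunnelWeight s n P = pow R q (stunnels P) ⊗ pow R s (n ∸ des P)

  G : Carrier → ℕ → Carrier
  G s n = sumDyck n (tunnelWeight s n)

  -- U A D: no new valley.
  tunnelWeight-UAD : ∀ s n A → isDyck A ≡ true → length A ≡ 2 ℕ.* n →
    tunnelWeight s (suc n) (U ∷ A ++ D ∷ []) ≈ s ⊗ tunnelWeight s n A
  tunnelWeight-UAD s n A dA lA = trans
    (*-cong (≡⇒≈ (P.cong (pow R q) (P.trans (FirstReturn.stunnels-W A [] dA P.refl) (ℕₚ.+-identityʳ _))))
            (≡⇒≈ (P.cong (pow R s) (P.trans (P.cong (suc n ∸_) (P.trans (FirstReturn.des-W A [] dA P.refl) (ℕₚ.+-identityʳ _)))
                                            (ℕₚ.+-∸-assoc 1 (des≤semilength A n dA lA))))))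
    (⊗-lcomm _ s _)

  ∸-+-distrib : ∀ a b x y → x ≤ a → y ≤ b → (a ℕ.+ b) ∸ (x ℕ.+ y) ≡ (a ∸ x) ℕ.+ (b ∸ y)
  ∸-+-distrib a       b zero    y _       y≤b = ℕₚ.+-∸-assoc a y≤b
  ∸-+-distrib (suc a) b (suc x) y (s≤s x≤a) y≤b = ∸-+-distrib a b x y x≤a y≤b

  -- U A D B with A ∈ 𝒟ₐ, B ≠ []: one new valley, whose tunnel U A D has semilength a+1.
  tunnelWeight-UADB : ∀ s n a A B → a < n → isDyck A ≡ true → length A ≡ 2 ℕ.* a →
    isDyck B ≡ true → length B ≡ 2 ℕ.* (n ∸ a) →
    tunnelWeight s (suc n) (U ∷ A ++ D ∷ B) ≈ pow R q (suc a) ⊗ (tunnelWeight s a A ⊗ tunnelWeight s (n ∸ a) B)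
  tunnelWeight-UADB s n a A [] a<n dA lA dB lB with () ← P.trans lB (P.cong (2 ℕ.*_) (ℕₚ.+-∸-assoc 1 a<n))
  tunnelWeight-UADB s n a A B@(_ ∷ _) a<n dA lA dB lB = begin
    pow R q (stunnels W) ⊗ pow R s (suc n ∸ des W)
      ≈⟨ *-cong (≡⇒≈ (P.cong (pow R q) stunnels≡)) (≡⇒≈ (P.cong (pow R s) valleys≡)) ⟩
    pow R q (stunnels A ℕ.+ (suc a ℕ.+ stunnels B)) ⊗ pow R s ((a ∸ des A) ℕ.+ (b ∸ des B))
      ≈⟨ *-cong (trans (pow-+ q (stunnels A) _) (*-congˡ (pow-+ q (suc a) (stunnels B)))) (pow-+ s (a ∸ des A) (b ∸ des B)) ⟩
    (pow R q (stunnels A) ⊗ (pow R q (suc a) ⊗ pow R q (stunnels B))) ⊗ (pow R s (a ∸ des A) ⊗ pow R s (b ∸ des B))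
      ≈⟨ trans (*-congʳ (⊗-lcomm _ _ _)) (*-assoc _ _ _) ⟩
    pow R q (suc a) ⊗ ((pow R q (stunnels A) ⊗ pow R q (stunnels B)) ⊗ (pow R s (a ∸ des A) ⊗ pow R s (b ∸ des B)))
      ≈⟨ *-congˡ (⊗-interchange _ _ _ _) ⟩
    pow R q (suc a) ⊗ (tunnelWeight s a A ⊗ tunnelWeight s (n ∸ a) B) ∎
    where
    W = U ∷ A ++ D ∷ B
    b = n ∸ a
    stunnels≡ : stunnels W ≡ stunnels A ℕ.+ (suc a ℕ.+ stunnels B)
    stunnels≡ = P.trans (FirstReturn.stunnels-W A B dA dB)
      (P.cong (λ z → stunnels A ℕ.+ (z ℕ.+ stunnels B)) (P.trans (P.cong (λ k → suc (suc k) ℕ./ 2) lA) (half-suc-suc-double a)))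
    valleys≡ : suc n ∸ des W ≡ (a ∸ des A) ℕ.+ (b ∸ des B)
    valleys≡ = P.trans (P.cong (suc n ∸_) (P.trans (FirstReturn.des-W A B dA dB) (ℕₚ.+-suc (des A) (des B))))
      (P.trans (P.cong (_∸ (des A ℕ.+ des B)) (P.sym (ℕₚ.m+[n∸m]≡n (ℕₚ.<⇒≤ a<n))))
               (∸-+-distrib a b (des A) (des B) (des≤semilength A a dA lA) (des≤semilength B b dB lB)))

  G-suc : ∀ s n → G s (suc n) ≈ tunnelStep q G s n
  G-suc s n = begin
    G s (suc n)         ≈⟨ firstReturn n (tunnelWeight s (suc n)) ⟩
    ⨁< n T ⊕ T n
      ≈⟨ +-cong (⨁<-cong n (λ a a<n → begin
            T a
              ≈⟨ sumDyck-cong-on a (λ A dA lA → sumDyck-cong-on (n ∸ a) (λ B dB lB →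
                   trans (tunnelWeight-UADB s n a A B a<n dA lA dB lB) (sym (*-assoc _ _ _)))) ⟩
            sumDyck a (λ A → sumDyck (n ∸ a) (λ B → (pow R q (suc a) ⊗ tunnelWeight s a A) ⊗ tunnelWeight s (n ∸ a) B))
              ≈⟨ sumDyck-product a (n ∸ a) (λ A → pow R q (suc a) ⊗ tunnelWeight s a A) (tunnelWeight s (n ∸ a)) ⟩
            sumDyck a (λ A → pow R q (suc a) ⊗ tunnelWeight s a A) ⊗ G s (n ∸ a)
              ≈⟨ trans (*-congʳ (sumDyck-*ˡ a (pow R q (suc a)) (tunnelWeight s a))) (*-assoc _ _ _) ⟩
            pow R q (suc a) ⊗ (G s a ⊗ G s (n ∸ a)) ∎))
          (begin
            T n
              ≈⟨ sumDyck-cong n (λ A → trans (≡⇒≈ (P.cong (λ m → sumDyck m (B-sum A)) (ℕₚ.n∸n≡0 n)))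
                                             (sumDyck-0 (B-sum A))) ⟩
            sumDyck n (λ A → tunnelWeight s (suc n) (U ∷ A ++ D ∷ []))
              ≈⟨ sumDyck-cong-on n (λ A dA lA → tunnelWeight-UAD s n A dA lA) ⟩
            sumDyck n (λ A → s ⊗ tunnelWeight s n A)
              ≈⟨ sumDyck-*ˡ n s (tunnelWeight s n) ⟩
            s ⊗ G s n ∎) ⟩
    tunnelStep q G s n  ∎
    where
    B-sum : List Step → List Step → Carrier
    B-sum A B = tunnelWeight s (suc n) (U ∷ A ++ D ∷ B)
    T : ℕ → Carrier
    T a = sumDyck a (λ A → sumDyck (n ∸ a) (B-sum A))

  F≈L : ∀ n s → F s n ≈ L s n
  F≈L = recursion-unique (peakStep q) (peakStep-cong q)
          (λ s → trans (sumDyck-0 (peakWeight s)) (trans (*-identityˡ 1#) (sym (L-0 s)))) F-suc L-peak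

  G≈L : ∀ n s → G s n ≈ L s n
  G≈L = recursion-unique (tunnelStep q) (tunnelStep-cong q)
          (λ s → trans (sumDyck-0 (tunnelWeight s 0)) (trans (*-identityˡ 1#) (sym (L-0 s)))) G-suc L-tunnel

-- Both sides equal L t n.
theorem4p2 : ∀ {c ℓ : Level} (R : CommutativeSemiring c ℓ) (n : ℕ) → n ≥ 1 →
    (q t : CommutativeSemiring.Carrier R) →
    CommutativeSemiring._≈_ R
    (sumR R (map (λ P → CommutativeSemiring._*_ R (pow R q (speaks P)) (pow R t (npeaks P))) (dyckPaths n)))
    (sumR R (map (λ P → CommutativeSemiring._*_ R (pow R q (stunnels P)) (pow R t (n ∸ des P))) (dyckPaths n)))
theorem4p2 R n _ q t = trans (F≈L n t) (sym (G≈L n t))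
  where
  open CommutativeSemiring R using (trans; sym)
  open Equidistribution R q using (F≈L; G≈L)
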